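{- Let $m\ge 3$ be odd, let $s$ be an even positive integer not divisible by $4$, and let $n=sm$. Let $$\sigma_1=(1,1,\dots,1,tc^{ -1})r,\qquad \sigma_2=(t,\gamma_2,\dots,\gamma_n)z,\qquad G=\langle\sigma_1,\sigma_2\rangle,$$ where for $2\le i\le n$, $\gamma_i=c$ if $i\equiv0$ or $3\pmod4$ and $\gamma_i=c^{ -1}$ if $i\equiv1$ or $2\pmod4$. Then $\Gamma=C_n[mK_1]$ is the skeleton of a polytopal non-orientable reflexible map $\mathcal{M}$ of type $\{2n,2m\}$ with $\mathrm{Aut}(\mathcal{M})=\mathrm{Aut}^+(\mathcal{M})=G$.
   Context: $C_n[mK_1]$ has vertex set $\{1,\dots,n\}\times\{1,\dots,m\}$ with $(i_1,j_1)\sim(i_2,j_2)$ iff $i_1\equiv i_2\pm1\pmod n$ (residues mod $n$ represented by $1,\dots,n$, mod $m$ by $1,\dots,m$). For $\alpha_i\in S_m$ and a permutation $x$ of $\{1,\dots,n\}$, $(\alpha_1,\dots,\alpha_n)x$ is the vertex permutation $(i,j)\mapsto(ix,j\alpha_i)$; permutations act on the right, products composed left to right. $c=(1\,2\,\cdots\,m)$, $t\in S_m$ fixes $1$ and swaps $j\leftrightarrow m-j+2$ ($2\le j\le m$), $r=(1\,2\,\cdots\,n)$, $z$ fixes $1$ and swaps $j\leftrightarrow n-j+2$ ($2\le j\le n$). A map is a connected finite graph (skeleton) embedded in a closed surface with open-disk faces; polytopal: each face boundary is a cycle and each edge lies on two distinct faces. Map automorphisms are skeleton automorphisms extending to homeomorphisms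 of the surface. Rotary: vertex stabilisers contain cyclic groups transitive on incident edges and face stabilisers contain cyclic groups transitive on the face's vertices; type $\{p,q\}$: faces have $p$ edges, skeleton is $q$-valent. Reflexible: a face stabiliser also contains a reflection of the face. $\mathrm{Aut}^+(\mathcal{M})$ is the rotational group generated by the distinguished generators (one-step rotation of a base face, and one-step rotation about a base vertex of that face, chosen so that their product is an involution reversing a base edge). -}

module Defs where

open import Data.Nat using (ℕ; zero; suc; _+_; _*_; _∸_; _<_; _≤_; _≟_)
open import Data.Nat.DivMod using (_mod_; _%_)
open import Data.Fin using (Fin; toℕ)
open import Data.Bool using (Bool; true; false; if_then_else_)
open import Data.Product using (Σ; _×_; _,_; ∃)
open import Data.Sum using (_⊎_)
open import Data.List using (List; []; _∷_)
open import Data.List.Membership.Propositional using (_∈_)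
open import Relation.Binary.PropositionalEquality using (_≡_; _≢_)
open import Relation.Nullary using (¬_; yes; no)
open import Function.Bundles using (_⇔_)

-- Cyclic arithmetic on Fin n (0-based: element k represents label k+1)

-- k ↦ k+1 (mod n)        (the permutation r on {1..n}, resp. c on {1..m})
inc : ∀ {n} → Fin n → Fin n
inc {zero} ()
inc {suc n} i = suc (toℕ i) mod suc n

dec : ∀ {n} → Fin n → Fin n
dec {zero} ()
dec {suc n} i = (toℕ i + n) mod suc n

-- label j ↦ n-j+2 (mod n), i.e. 0-based k ↦ -k (mod n)   (the maps z, t)
neg : ∀ {n} → Fin n → Fin n
neg {zero} ()
neg {suc n} i = (suc n ∸ toℕ i) mod suc n

V : ℕ → ℕ → Set
V n m = Fin n × Fin m

Adj : ∀ {n m} → V n m → V n m → Set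
Adj (i₁ , _) (i₂ , _) = (i₂ ≡ inc i₁) ⊎ (i₁ ≡ inc i₂)

-- σ₁ = (1,…,1,t c⁻¹) r : (i,j) ↦ (i r, j α_i), α_n = t c⁻¹ (t first), else 1
σ₁ : ∀ {n m} → V n m → V n m
σ₁ {n} (i , j) with suc (toℕ i) ≟ n
... | yes _ = inc i , dec (neg j)
... | no  _ = inc i , j

-- γ_i for label i = k+1 : c if i ≡ 0,3 (mod 4), c⁻¹ if i ≡ 1,2 (mod 4)
γ : ∀ {m} → ℕ → Fin m → Fin m
γ k j with suc k % 4
... | 0 = inc j
... | 3 = inc j
... | _ = dec j

-- σ₂ = (t, γ₂, …, γ_n) z
σ₂ : ∀ {n m} → V n m → V n m
σ₂ (i , j) with toℕ i
... | zero  = neg i , neg j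
... | suc k = neg i , γ (suc k) j

evalG : ∀ {n m} → List Bool → V n m → V n m
evalG []      v = v
evalG (b ∷ w) v = evalG w (if b then σ₁ v else σ₂ v)

-- membership in G = ⟨σ₁, σ₂⟩ (finite group, so the generated monoid is
-- the generated subgroup); permutations compared pointwise
InG : ∀ {n m} → (V n m → V n m) → Set
InG g = Σ (List Bool) λ w → ∀ v → g v ≡ evalG w v

iter : ∀ {A : Set} → ℕ → (A → A) → A → A
iter zero    h a = a
iter (suc k) h a = iter k h (h a)

data Conn {N : ℕ} (gs : List (Fin N → Fin N)) : Fin N → Fin N → Set where
  here : ∀ {f} → Conn gs f f
  step : ∀ {f g h} → h ∈ gs → Conn gs (h f) g → Conn gs f g

record Map : Set where
  field
    N  : ℕ
    r₀ r₁ r₂ : Fin N → Fin N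
    inv₀ : ∀ f → r₀ (r₀ f) ≡ f
    inv₁ : ∀ f → r₁ (r₁ f) ≡ f
    inv₂ : ∀ f → r₂ (r₂ f) ≡ f
    fpf₀ : ∀ f → r₀ f ≢ f
    fpf₁ : ∀ f → r₁ f ≢ f
    fpf₂ : ∀ f → r₂ f ≢ f
    comm₀₂ : ∀ f → r₀ (r₂ f) ≡ r₂ (r₀ f)
    fpf₀₂  : ∀ f → r₀ (r₂ f) ≢ f
    connected : ∀ f g → Conn (r₀ ∷ r₁ ∷ r₂ ∷ []) f g

module _ (M : Map) where
  open Map M

  SameV SameE SameF : Fin N → Fin N → Set
  SameV = Conn (r₁ ∷ r₂ ∷ [])
  SameE = Conn (r₀ ∷ r₂ ∷ [])
  SameF = Conn (r₀ ∷ r₁ ∷ [])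

  faceStep vertStep : Fin N → Fin N
  faceStep f = r₁ (r₀ f)
  vertStep f = r₁ (r₂ f)

  ExactOrder : (Fin N → Fin N) → ℕ → Set
  ExactOrder h p = ∀ f → iter p h f ≡ f × (∀ k → 0 < k → k < p → iter k h f ≢ f)

  HasType : ℕ → ℕ → Set
  HasType p q = ExactOrder faceStep p × ExactOrder vertStep q

  record IsSkeleton {n m : ℕ} (vtx : Fin N → V n m) : Set where
    field
      vertices : ∀ f g → (vtx f ≡ vtx g) ⇔ SameV f g
      onto     : ∀ v → ∃ λ f → vtx f ≡ v
      edgeAdj  : ∀ f → Adj (vtx f) (vtx (r₀ f))
      adjEdge  : ∀ u v → Adj u v → ∃ λ f → vtx f ≡ u × vtx (r₀ f) ≡ v
      simple   : ∀ f g → vtx f ≡ vtx g → vtx (r₀ f) ≡ vtx (r₀ g) → SameE f g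

  -- polytopal: face boundaries are cycles, each edge on two distinct faces
  Polytopal : ∀ {n m} → (Fin N → V n m) → ℕ → Set
  Polytopal vtx p =
    (∀ f k l → k < p → l < p → vtx (iter k faceStep f) ≡ vtx (iter l faceStep f) → k ≡ l)
    × (∀ f → ¬ SameF f (r₂ f))

  NonOrientable : Set
  NonOrientable = ¬ (Σ (Fin N → Bool) λ col →
    ∀ f → col (r₀ f) ≢ col f × col (r₁ f) ≢ col f × col (r₂ f) ≢ col f)

  IsAut : (Fin N → Fin N) → Set
  IsAut φ = ∀ f → φ (r₀ f) ≡ r₀ (φ f) × φ (r₁ f) ≡ r₁ (φ f) × φ (r₂ f) ≡ r₂ (φ f)

  Induces : ∀ {n m} → (Fin N → V n m) → (Fin N → Fin N) → (V n m → V n m) → Set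
  Induces vtx φ g = ∀ f → vtx (φ f) ≡ g (vtx f)

  Reflexible : Set
  Reflexible = ∀ f g → ∃ λ φ → IsAut φ × φ f ≡ g

  AutIsG : ∀ {n m} → (Fin N → V n m) → Set
  AutIsG {n} {m} vtx =
    (∀ φ → IsAut φ → ∃ λ (g : V n m → V n m) → InG g × Induces vtx φ g)
    × (∀ (g : V n m → V n m) → InG g → ∃ λ φ → IsAut φ × Induces vtx φ g)

  evalF : (Fin N → Fin N) → (Fin N → Fin N) → List Bool → Fin N → Fin N
  evalF R S []      f = f
  evalF R S (b ∷ w) f = evalF R S w (if b then R f else S f)

  -- distinguished generators at base flag f₀:
  -- R rotates the base face one step, S rotates about the base vertex,
  -- R then S maps f₀ to r₀ (r₂ f₀) (reverses the base edge)
  Distinguished : Fin N → (Fin N → Fin N) → (Fin N → Fin N) → Set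
  Distinguished f₀ R S = IsAut R × IsAut S × R f₀ ≡ r₀ (r₁ f₀) × S f₀ ≡ r₁ (r₂ f₀)

  AutPlusIsG : ∀ {n m} → (Fin N → V n m) → Set
  AutPlusIsG {n} {m} vtx = ∀ f₀ R S → Distinguished f₀ R S →
    (∀ w → ∃ λ (g : V n m → V n m) → InG g × Induces vtx (evalF R S w) g)
    × (∀ (g : V n m → V n m) → InG g → ∃ λ w → Induces vtx (evalF R S w) g)

-- Write n = 2h with h odd. Give the vertex (i, j) of C_n[mK_1] the coordinates i mod 2, i mod h
-- and (-1)^⌊i/2⌋ (2j + 1) mod m. In these coordinates σ₁ and σ₂ become affine maps of
-- ℤ₂ × ℤ_h × ℤ_m, and G is an explicit group of such maps, of order 8hm². It contains involutions
-- ρ₀, ρ₁, ρ₂ with ρ₀ρ₁ = σ₁, ρ₁ρ₂ = σ₂ and ρ₀ρ₂ = ρ₂ρ₀, and the map is the regular map whose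
-- flags are the elements of G, with r_i the left multiplication by ρ_i. Its automorphisms are
-- exactly the right multiplications, so Aut = Aut⁺ = G; as σ₁ and σ₂ already generate G, the
-- reflection ρ₁ is a rotation and the map is non-orientable. The vertex of a flag g is the image
-- of a base vertex under g; its stabiliser is ⟨ρ₁, ρ₂⟩ and the stabiliser of a base arc is
-- ⟨ρ₂⟩, which makes the skeleton exactly C_n[mK_1]. Faces have 2n edges because ρ₁ρ₀ has order
-- 2n and moves the base vertex along 2n distinct vertices, and ρ₂ ∉ ⟨ρ₀, ρ₁⟩ because ρ₀, ρ₁ keep
-- the fibre coordinate in {1, -1}. Nothing uses m ∣ n: the argument works whenever
-- n ≡ 2 (mod 4), n ≥ 6 and m ≥ 3 is odd.

module Submission where

open import Defs
open import Data.Nat as ℕ using (ℕ; zero; suc)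
open import Data.Fin using (Fin)
open import Data.Bool using (Bool; true; false; not; if_then_else_)
open import Data.Bool.Properties using (¬-not; not-involutive)
open import Data.List using (List; []; _∷_; _++_; map; replicate)
open import Data.List.Membership.Propositional.Properties using (∈-map⁺; ∈-map⁻)
open import Data.List.Relation.Unary.All using (All; []; _∷_)
open import Data.List.Relation.Unary.Any using (here; there)
open import Data.List.Membership.Propositional using (_∈_)
open import Data.Product using (Σ; _×_; _,_; ∃; proj₁; proj₂)
open import Level using (0ℓ)
open import Algebra.Bundles using (Group)
import Algebra.Properties.Group as GroupProperties
import Algebra.Properties.Quasigroup as QuasigroupProperties
open import Relation.Nullary using (¬_)
open import Relation.Binary.PropositionalEquality using (_≢_)
open import Relation.Binary.PropositionalEquality as ≡ using (_≡_; cong; subst)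
import Relation.Binary.Reasoning.Setoid as SetoidReasoning

module Congruence where

  open import Data.Nat as ℕ using (ℕ; suc; NonZero)
  import Data.Nat.Properties as ℕ
  import Data.Nat.DivMod as ℕ
  open import Data.Integer using (ℤ; +_; -[1+_]; _+_; _*_; -_; _-_; _%ℕ_; _/ℕ_)
  open import Data.Integer.Properties using (+-injective; pos-+; pos-*)
  open import Data.Integer.DivMod using (a≡a%ℕn+[a/ℕn]*n; n%ℕd<d)
  open import Data.Integer.Tactic.RingSolver using (solve-∀)
  open import Data.Fin using (Fin; toℕ; fromℕ<)
  import Data.Fin.Properties as Fin
  open import Data.Nat.Divisibility using (divides; m%n≡0⇒n∣m)
  open import Data.Product using (∃; _,_)
  open import Relation.Binary.PropositionalEquality

  infix 4 _≡_[mod_]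
  infixr 4 _,_

  record _≡_[mod_] (x y : ℤ) (k : ℕ) : Set where
    constructor _,_
    field
      quotient : ℤ
      equation : x ≡ y + quotient * + k

  module _ {k : ℕ} where

    mod-refl : ∀ {x} → x ≡ x [mod k ]
    mod-refl {x} = + 0 , x≡x+0*k x (+ k)
      where
      x≡x+0*k : ∀ x k → x ≡ x + + 0 * k
      x≡x+0*k = solve-∀

    mod-reflexive : ∀ {x y} → x ≡ y → x ≡ y [mod k ]
    mod-reflexive refl = mod-refl

    mod-sym : ∀ {x y} → x ≡ y [mod k ] → y ≡ x [mod k ]
    mod-sym {y = y} (q , refl) = - q , shift-back y q (+ k)
      where
      shift-back : ∀ y q k → y ≡ y + q * k + - q * k
      shift-back = solve-∀

    mod-trans : ∀ {x y z} → x ≡ y [mod k ] → y ≡ z [mod k ] → x ≡ z [mod k ]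
    mod-trans {z = z} (q , refl) (r , refl) = q + r , collect z q r (+ k)
      where
      collect : ∀ z q r k → z + r * k + q * k ≡ z + (q + r) * k
      collect = solve-∀

    mod-+ : ∀ {x x′ y y′} → x ≡ x′ [mod k ] → y ≡ y′ [mod k ] → x + y ≡ x′ + y′ [mod k ]
    mod-+ {x′ = x′} {y′ = y′} (q , refl) (r , refl) = q + r , collect x′ y′ q r (+ k)
      where
      collect : ∀ x y q r k → x + q * k + (y + r * k) ≡ x + y + (q + r) * k
      collect = solve-∀

    mod-neg : ∀ {x x′} → x ≡ x′ [mod k ] → - x ≡ - x′ [mod k ]
    mod-neg {x′ = x′} (q , refl) = - q , distrib x′ q (+ k)
      where
      distrib : ∀ x q k → - (x + q * k) ≡ - x + - q * k
      distrib = solve-∀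

    mod-*ˡ : ∀ c {x x′} → x ≡ x′ [mod k ] → c * x ≡ c * x′ [mod k ]
    mod-*ˡ c {x′ = x′} (q , refl) = c * q , distrib c x′ q (+ k)
      where
      distrib : ∀ c x q k → c * (x + q * k) ≡ c * x + c * q * k
      distrib = solve-∀

    mod-+ʳ : ∀ c {x x′} → x ≡ x′ [mod k ] → x + c ≡ x′ + c [mod k ]
    mod-+ʳ c p = mod-+ p (mod-refl {c})

    mod-+ˡ : ∀ c {x x′} → x ≡ x′ [mod k ] → c + x ≡ c + x′ [mod k ]
    mod-+ˡ c p = mod-+ (mod-refl {c}) p

    mod-cancel-+ʳ : ∀ c {x x′} → x + c ≡ x′ + c [mod k ] → x ≡ x′ [mod k ]
    mod-cancel-+ʳ c {x} {x′} p =
      mod-trans (mod-reflexive (sym (cancel x c))) (mod-trans (mod-+ʳ (- c) p) (mod-reflexive (cancel x′ c)))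
      where
      cancel : ∀ x c → x + c + - c ≡ x
      cancel = solve-∀

    mod-sub : ∀ {x y} → x ≡ y [mod k ] → x - y ≡ + 0 [mod k ]
    mod-sub {x} {y} p = mod-trans (mod-+ʳ (- y) p) (mod-reflexive (cancel y))
      where
      cancel : ∀ y → y - y ≡ + 0
      cancel = solve-∀

    mod-isolate : ∀ s {x t} → s + x ≡ t [mod k ] → x ≡ t - s [mod k ]
    mod-isolate s {x} p = mod-trans (mod-reflexive (sym (cancel s x))) (mod-+ʳ (- s) p)
      where
      cancel : ∀ s x → s + x - s ≡ x
      cancel = solve-∀

  module _ {k : ℕ} where

    private
      ℕ-cancel : ∀ {r r′ q} → r ℕ.< k → r′ ℕ.< k → r ≡ r′ ℕ.+ q ℕ.* k → r ≡ r′
      ℕ-cancel {r} {r′} {q} r<k r′<k e = begin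
        r                    ≡⟨ ℕ.m<n⇒m%n≡m r<k ⟨
        r ℕ.% k              ≡⟨ cong (ℕ._% k) e ⟩
        (r′ ℕ.+ q ℕ.* k) ℕ.% k ≡⟨ ℕ.[m+kn]%n≡m%n r′ q k ⟩
        r′ ℕ.% k             ≡⟨ ℕ.m<n⇒m%n≡m r′<k ⟩
        r′                   ∎
        where
        open ≡-Reasoning
        instance
          k≢0 : NonZero k
          k≢0 = ℕ.>-nonZero (ℕ.≤-<-trans ℕ.z≤n r<k)

      embed : ∀ r′ q → + (r′ ℕ.+ q ℕ.* k) ≡ + r′ + + q * + k
      embed r′ q = trans (pos-+ r′ (q ℕ.* k)) (cong (λ z → + r′ + z) (pos-* q k))

    mod-small-unique : ∀ {r r′} → r ℕ.< k → r′ ℕ.< k → + r ≡ + r′ [mod k ] → r ≡ r′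
    mod-small-unique {r} {r′} r<k r′<k (+ q , e) =
      ℕ-cancel {q = q} r<k r′<k (+-injective (trans e (sym (embed r′ q))))
    mod-small-unique {r} {r′} r<k r′<k (-[1+ q ] , e) =
      sym (ℕ-cancel {q = suc q} r′<k r<k (+-injective (trans (flip (+ r) (+ r′) q (+ k) e) (sym (embed r (suc q))))))
      where
      flip : ∀ x y q k → x ≡ y + -[1+ q ] * k → y ≡ x + + suc q * k
      flip x y q k refl = rearrange y (+ suc q) k
        where
        rearrange : ∀ y q k → y ≡ y + - q * k + q * k
        rearrange = solve-∀

  module _ (k : ℕ) .{{_ : NonZero k}} where

    mod-%ℕ : ∀ x → x ≡ + (x %ℕ k) [mod k ]
    mod-%ℕ x = x /ℕ k , a≡a%ℕn+[a/ℕn]*n x k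

    %ℕ-cong : ∀ {x y} → x ≡ y [mod k ] → x %ℕ k ≡ y %ℕ k
    %ℕ-cong {x} {y} p = mod-small-unique (n%ℕd<d x k) (n%ℕd<d y k)
      (mod-trans (mod-sym (mod-%ℕ x)) (mod-trans p (mod-%ℕ y)))

    toFin : ℤ → Fin k
    toFin x = fromℕ< (n%ℕd<d x k)

    fromFin : Fin k → ℤ
    fromFin i = + toℕ i

    toℕ-toFin : ∀ x → toℕ (toFin x) ≡ x %ℕ k
    toℕ-toFin x = Fin.toℕ-fromℕ< (n%ℕd<d x k)

    toFin-cong : ∀ {x y} → x ≡ y [mod k ] → toFin x ≡ toFin y
    toFin-cong {x} {y} p = Fin.toℕ-injective (trans (toℕ-toFin x) (trans (%ℕ-cong p) (sym (toℕ-toFin y))))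

    fromFin-toFin : ∀ x → fromFin (toFin x) ≡ x [mod k ]
    fromFin-toFin x = subst (λ r → + r ≡ x [mod k ]) (sym (toℕ-toFin x)) (mod-sym (mod-%ℕ x))

    mod⇒multiple : ∀ d → + d ≡ + 0 [mod k ] → ∃ λ j → d ≡ j ℕ.* k
    mod⇒multiple d d≡0 with m%n≡0⇒n∣m d k (trans (%ℕ-cong d≡0) (ℕ.m<n⇒m%n≡m (ℕ.>-nonZero⁻¹ k)))
    ... | divides j d≡jk = j , d≡jk

    toFin-fromFin : ∀ i → toFin (fromFin i) ≡ i
    toFin-fromFin i = Fin.toℕ-injective (trans (toℕ-toFin (fromFin i)) (ℕ.m<n⇒m%n≡m (Fin.toℕ<n i)))

open Congruence

module Parity where

  open import Data.Integer using (ℤ; +_; _+_; _*_; -_)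
  open import Data.Bool using (Bool; true; false; not; _xor_; _∧_)
  open import Data.Bool.Properties using (xor-∧-commutativeRing; xor-identityʳ; xor-same; not-injective)
  open import Data.Integer.Tactic.RingSolver using (solve-∀)
  import Data.Nat.Properties as ℕ
  open import Data.Product using (∃; _,_)
  open import Data.Maybe using (just; nothing)
  open import Tactic.RingSolver.Core.AlmostCommutativeRing using (AlmostCommutativeRing; fromCommutativeRing)
  open import Tactic.RingSolver using () renaming (solve-∀ to solve-∀-in)
  open import Relation.Binary.PropositionalEquality

  𝔽₂ : AlmostCommutativeRing 0ℓ 0ℓ
  𝔽₂ = fromCommutativeRing xor-∧-commutativeRing λ { false → just refl ; true → nothing }

  sign : Bool → ℤ
  sign false = + 1
  sign true  = - + 1

  sign-xor : ∀ a b → sign (a xor b) ≡ sign a * sign b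
  sign-xor false false = refl
  sign-xor false true  = refl
  sign-xor true  false = refl
  sign-xor true  true  = refl

  sign-sq : ∀ a → sign a * sign a ≡ + 1
  sign-sq false = refl
  sign-sq true  = refl

  sign-involutive : ∀ a x → sign a * (sign a * x) ≡ x
  sign-involutive a x = trans (regroup (sign a) x) (trans (cong (_* x) (sign-sq a)) (unit x))
    where
    regroup : ∀ s x → s * (s * x) ≡ (s * s) * x
    regroup = solve-∀
    unit : ∀ x → + 1 * x ≡ x
    unit = solve-∀

  sign-injective : ∀ {k} → 2 ℕ.< k → ∀ {a b} → sign a ≡ sign b [mod k ] → a ≡ b
  sign-injective _   {false} {false} _ = refl
  sign-injective _   {true}  {true}  _ = refl
  sign-injective {suc _} 2<k {false} {true}  p with mod-small-unique 2<k ℕ.z<s (mod-+ʳ (+ 1) p)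
  ... | ()
  sign-injective {suc _} 2<k {true}  {false} p with mod-small-unique 2<k ℕ.z<s (mod-+ʳ (+ 1) (mod-sym p))
  ... | ()

  odd : ℕ → Bool
  odd zero    = false
  odd (suc k) = not (odd k)

  oddHalf : ℕ → Bool
  oddHalf zero    = false
  oddHalf (suc k) = oddHalf k xor odd k

  odd-+ : ∀ x y → odd (x ℕ.+ y) ≡ odd x xor odd y
  odd-+ zero    y = refl
  odd-+ (suc x) y = trans (cong not (odd-+ x y)) (carry (odd x) (odd y))
    where
    carry : ∀ a b → true xor (a xor b) ≡ (true xor a) xor b
    carry = solve-∀-in 𝔽₂

  odd-double : ∀ x → odd (x ℕ.+ x) ≡ false
  odd-double x = trans (odd-+ x x) (xor-same (odd x))

  odd-2* : ∀ x → odd (2 ℕ.* x) ≡ false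
  odd-2* x = trans (cong (λ y → odd (x ℕ.+ y)) (ℕ.+-identityʳ x)) (odd-double x)

  oddHalf-+ : ∀ x y → oddHalf (x ℕ.+ y) ≡ (oddHalf x xor oddHalf y) xor (odd x ∧ odd y)
  oddHalf-+ zero    y = sym (xor-identityʳ (oddHalf y))
  oddHalf-+ (suc x) y =
    trans (cong₂ _xor_ (oddHalf-+ x y) (odd-+ x y)) (carry (oddHalf x) (oddHalf y) (odd x) (odd y))
    where
    carry : ∀ a b c d → ((a xor b) xor (c ∧ d)) xor (c xor d) ≡ ((a xor c) xor b) xor ((true xor c) ∧ d)
    carry = solve-∀-in 𝔽₂

  even⇒double : ∀ k → odd k ≡ false → ∃ λ l → k ≡ l ℕ.+ l
  odd⇒suc-double : ∀ k → odd k ≡ true → ∃ λ l → k ≡ suc (l ℕ.+ l)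
  even⇒double zero    _ = 0 , refl
  even⇒double (suc k) e with odd⇒suc-double k (not-injective e)
  ... | l , refl = suc l , cong suc (sym (ℕ.+-suc l l))
  odd⇒suc-double zero    ()
  odd⇒suc-double (suc k) o with even⇒double k (not-injective o)
  ... | l , refl = l , refl

open Parity

module AffineGroup (h m : ℕ) (2<h : 2 ℕ.< h) (2<m : 2 ℕ.< m) where

  open import Data.Nat as ℕ using (ℕ)
  open import Data.Integer using (ℤ; +_; _+_; _*_; -_; _-_)
  open import Data.Integer.Tactic.RingSolver using (solve-∀)
  open import Data.Bool using (Bool; true; false; not; _xor_; _∧_)
  open import Data.Bool.Properties using (xor-assoc)
  open import Data.Product using (_,_)
  open import Relation.Binary.Bundles using (Setoid)
  open import Relation.Binary.Structures using (IsEquivalence)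
  open import Tactic.RingSolver using () renaming (solve-∀ to solve-∀-in)
  open import Relation.Binary.PropositionalEquality

  record Point : Set where
    constructor ⟨_,_,_⟩
    field
      parity : Bool
      cyc    : ℤ
      fib    : ℤ
  open Point public

  infix 4 _≈ₚ_ _≈_

  record _≈ₚ_ (x y : Point) : Set where
    constructor ≈ₚ⟨_,_,_⟩
    field
      parity≡ : parity x ≡ parity y
      cyc≡    : cyc x ≡ cyc y [mod h ]
      fib≡    : fib x ≡ fib y [mod m ]

  ≈ₚ-isEquivalence : IsEquivalence _≈ₚ_
  ≈ₚ-isEquivalence = record
    { refl  = ≈ₚ⟨ refl , mod-refl , mod-refl ⟩
    ; sym   = λ { ≈ₚ⟨ p , q , v ⟩ → ≈ₚ⟨ sym p , mod-sym q , mod-sym v ⟩ }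
    ; trans = λ { ≈ₚ⟨ p , q , v ⟩ ≈ₚ⟨ p′ , q′ , v′ ⟩ → ≈ₚ⟨ trans p p′ , mod-trans q q′ , mod-trans v v′ ⟩ }
    }

  pointSetoid : Setoid 0ℓ 0ℓ
  pointSetoid = record { isEquivalence = ≈ₚ-isEquivalence }

  open IsEquivalence ≈ₚ-isEquivalence public
    using () renaming (refl to ≈ₚ-refl; sym to ≈ₚ-sym; trans to ≈ₚ-trans; reflexive to ≈ₚ-reflexive)

  -- A point ⟨ p , q , v ⟩ stands for the vertex with index ≡ p (mod 2), ≡ q (mod h) and fibre
  -- coordinate v (mod m).  An element swaps the parities or not, acts on ℤ_h by q ↦ ± q + shift
  -- and on the fibre over parity p by v ↦ ± v + shiftAt p.  The sign over odd points is not free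
  -- but forced to be revAt true: this is what cuts G out of the full group of such maps.
  record Elt : Set where
    constructor mk
    field
      rev    : Bool
      swap   : Bool
      shift  : ℤ
      rev₀   : Bool
      shift₀ : ℤ
      shift₁ : ℤ
  open Elt public

  revAt : Bool → Elt → Bool
  revAt p g = (p ∧ (rev g xor swap g)) xor rev₀ g

  shiftAt : Bool → Elt → ℤ
  shiftAt false g = shift₀ g
  shiftAt true  g = shift₁ g

  record _≈_ (g k : Elt) : Set where
    constructor ≈⟨_,_,_,_,_,_⟩
    field
      rev≡    : rev g ≡ rev k
      swap≡   : swap g ≡ swap k
      shift≡  : shift g ≡ shift k [mod h ]
      rev₀≡   : rev₀ g ≡ rev₀ k
      shift₀≡ : shift₀ g ≡ shift₀ k [mod m ]
      shift₁≡ : shift₁ g ≡ shift₁ k [mod m ]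

  ≈-isEquivalence : IsEquivalence _≈_
  ≈-isEquivalence = record
    { refl  = ≈⟨ refl , refl , mod-refl , refl , mod-refl , mod-refl ⟩
    ; sym   = λ { ≈⟨ a , b , c , d , e , f ⟩ → ≈⟨ sym a , sym b , mod-sym c , sym d , mod-sym e , mod-sym f ⟩ }
    ; trans = λ { ≈⟨ a , b , c , d , e , f ⟩ ≈⟨ a′ , b′ , c′ , d′ , e′ , f′ ⟩ →
                  ≈⟨ trans a a′ , trans b b′ , mod-trans c c′ , trans d d′ , mod-trans e e′ , mod-trans f f′ ⟩ }
    }

  open IsEquivalence ≈-isEquivalence public
    using () renaming (refl to ≈-refl; sym to ≈-sym; trans to ≈-trans; reflexive to ≈-reflexive)

  act : Elt → Point → Point
  act g ⟨ p , q , v ⟩ = ⟨ p xor swap g , sign (rev g) * q + shift g , sign (revAt p g) * v + shiftAt p g ⟩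

  -- Composition left to right, as in the paper: act (g ∙ k) = act k ∘ act g.
  infixl 7 _∙_
  _∙_ : Elt → Elt → Elt
  g ∙ k = mk (rev g xor rev k) (swap g xor swap k) (sign (rev k) * shift g + shift k)
             (revAt (swap g) k xor rev₀ g)
             (sign (revAt (swap g) k) * shift₀ g + shiftAt (swap g) k)
             (sign (revAt (not (swap g)) k) * shift₁ g + shiftAt (not (swap g)) k)

  e : Elt
  e = mk false false (+ 0) false (+ 0) (+ 0)

  infix 8 _⁻¹
  _⁻¹ : Elt → Elt
  g ⁻¹ = mk (rev g) (swap g) (- (sign (rev g) * shift g)) (revAt (swap g) g)
            (- (sign (revAt (swap g) g) * shiftAt (swap g) g))
            (- (sign (revAt (not (swap g)) g) * shiftAt (not (swap g)) g))

  revAt-∙ : ∀ p g k → revAt p (g ∙ k) ≡ revAt (p xor swap g) k xor revAt p g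
  revAt-∙ p (mk r s _ η _ _) (mk r′ s′ _ η′ _ _) = identity p r s η r′ s′ η′
    where
    identity : ∀ p r s η r′ s′ η′ →
      (p ∧ ((r xor r′) xor (s xor s′))) xor (((s ∧ (r′ xor s′)) xor η′) xor η)
        ≡ (((p xor s) ∧ (r′ xor s′)) xor η′) xor ((p ∧ (r xor s)) xor η)
    identity = solve-∀-in 𝔽₂

  act-∙ : ∀ g k x → act (g ∙ k) x ≈ₚ act k (act g x)
  act-∙ g k ⟨ p , q , v ⟩ = ≈ₚ⟨ sym (xor-assoc p (swap g) (swap k)) , mod-reflexive cyc-eq , mod-reflexive (fib-eq p) ⟩
    where
    affine : ∀ s t v b c → (s * t) * v + (s * b + c) ≡ s * (t * v + b) + c
    affine = solve-∀
    affine′ : ∀ s t v b c → (t * s) * v + (s * b + c) ≡ s * (t * v + b) + c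
    affine′ = solve-∀
    cyc-eq : sign (rev g xor rev k) * q + (sign (rev k) * shift g + shift k)
             ≡ sign (rev k) * (sign (rev g) * q + shift g) + shift k
    cyc-eq = trans (cong (λ s → s * q + (sign (rev k) * shift g + shift k)) (sign-xor (rev g) (rev k)))
                   (affine′ (sign (rev k)) (sign (rev g)) q (shift g) (shift k))
    fib-eq : ∀ p → sign (revAt p (g ∙ k)) * v + shiftAt p (g ∙ k)
                   ≡ sign (revAt (p xor swap g) k) * (sign (revAt p g) * v + shiftAt p g) + shiftAt (p xor swap g) k
    fib-eq p = trans (cong (λ s → s * v + shiftAt p (g ∙ k))
                       (trans (cong sign (revAt-∙ p g k)) (sign-xor (revAt (p xor swap g) k) (revAt p g))))
                     (fib-affine p)
      where
      fib-affine : ∀ p → sign (revAt (p xor swap g) k) * sign (revAt p g) * v + shiftAt p (g ∙ k)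
                         ≡ sign (revAt (p xor swap g) k) * (sign (revAt p g) * v + shiftAt p g) + shiftAt (p xor swap g) k
      fib-affine false = affine (sign (revAt (swap g) k)) (sign (rev₀ g)) v (shift₀ g) (shiftAt (swap g) k)
      fib-affine true  = affine (sign (revAt (not (swap g)) k)) (sign (revAt true g)) v (shift₁ g) (shiftAt (not (swap g)) k)

  act-cong : ∀ {g g′ x x′} → g ≈ g′ → x ≈ₚ x′ → act g x ≈ₚ act g′ x′
  act-cong {mk r s _ η _ _} {x = ⟨ p , _ , _ ⟩} ≈⟨ refl , refl , cq , refl , c₀ , c₁ ⟩ ≈ₚ⟨ refl , cq′ , cv′ ⟩ =
    ≈ₚ⟨ refl , mod-+ (mod-*ˡ (sign r) cq′) cq , mod-+ (mod-*ˡ (sign (revAt p (mk r s (+ 0) η (+ 0) (+ 0)))) cv′) (shiftAt-cong p) ⟩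
    where
    shiftAt-cong : ∀ p → shiftAt p _ ≡ shiftAt p _ [mod m ]
    shiftAt-cong false = c₀
    shiftAt-cong true  = c₁

  -- Three points suffice to read off every coordinate; the signs are recovered because
  -- 1 ≢ -1 modulo h and m, which is where 2 < h and 2 < m are needed.
  faithful : ∀ g g′ → (∀ x → act g x ≈ₚ act g′ x) → g ≈ g′
  faithful g g′ same = ≈⟨ rev≡ , _≈ₚ_.parity≡ at₀₀ , shift≡ , rev₀≡ , shift₀≡ , shift₁≡ ⟩
    where
    at₀₀ = same ⟨ false , + 0 , + 0 ⟩
    at₀₁ = same ⟨ false , + 0 , + 1 ⟩
    at₁₀ = same ⟨ true  , + 1 , + 0 ⟩
    zero-arg : ∀ s a → s * + 0 + a ≡ a
    zero-arg = solve-∀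
    one-arg : ∀ s a → s * + 1 + a ≡ s + a
    one-arg = solve-∀
    offset : ∀ {k} s s′ {a a′} → s * + 0 + a ≡ s′ * + 0 + a′ [mod k ] → a ≡ a′ [mod k ]
    offset s s′ {a} {a′} c = mod-trans (mod-reflexive (sym (zero-arg s a))) (mod-trans c (mod-reflexive (zero-arg s′ a′)))
    slope : ∀ {k} s s′ {a a′} → a ≡ a′ [mod k ] → s * + 1 + a ≡ s′ * + 1 + a′ [mod k ] → s ≡ s′ [mod k ]
    slope s s′ {a} {a′} ca c = mod-cancel-+ʳ a (mod-trans (mod-reflexive (sym (one-arg s a)))
      (mod-trans c (mod-trans (mod-reflexive (one-arg s′ a′)) (mod-+ˡ (s′) (mod-sym ca)))))
    shift≡  = offset (sign (rev g)) (sign (rev g′)) (_≈ₚ_.cyc≡ at₀₀)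
    shift₀≡ = offset (sign (rev₀ g)) (sign (rev₀ g′)) (_≈ₚ_.fib≡ at₀₀)
    shift₁≡ = offset (sign (revAt true g)) (sign (revAt true g′)) (_≈ₚ_.fib≡ at₁₀)
    rev₀≡ = sign-injective 2<m (slope (sign (rev₀ g)) (sign (rev₀ g′)) shift₀≡ (_≈ₚ_.fib≡ at₀₁))
    rev≡  = sign-injective 2<h (slope (sign (rev g)) (sign (rev g′)) shift≡ (_≈ₚ_.cyc≡ at₁₀))

  act-⁻¹ : ∀ g x → act (g ⁻¹) (act g x) ≈ₚ x
  act-⁻¹ g@(mk r s a η b₀ b₁) ⟨ p , q , v ⟩ =
    ≈ₚ⟨ xor-cancelʳ p s , mod-reflexive (undo r q a) , mod-reflexive fib-eq ⟩
    where
    xor-cancelʳ : ∀ p s → (p xor s) xor s ≡ p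
    xor-cancelʳ = solve-∀-in 𝔽₂
    undo : ∀ r q a → sign r * (sign r * q + a) + - (sign r * a) ≡ q
    undo r q a = trans (expand (sign r) q a) (sign-involutive r q)
      where
      expand : ∀ s q a → s * (s * q + a) + - (s * a) ≡ s * (s * q)
      expand = solve-∀
    revAt-⁻¹ : ∀ p → revAt (p xor s) (g ⁻¹) ≡ revAt p g
    revAt-⁻¹ p = identity p r s η
      where
      identity : ∀ p r s η → ((p xor s) ∧ (r xor s)) xor ((s ∧ (r xor s)) xor η) ≡ (p ∧ (r xor s)) xor η
      identity = solve-∀-in 𝔽₂
    shiftAt-⁻¹ : ∀ p s → shiftAt (p xor s) (mk r s a η b₀ b₁ ⁻¹) ≡ - (sign (revAt p (mk r s a η b₀ b₁)) * shiftAt p (mk r s a η b₀ b₁))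
    shiftAt-⁻¹ false false = refl
    shiftAt-⁻¹ false true  = refl
    shiftAt-⁻¹ true  false = refl
    shiftAt-⁻¹ true  true  = refl
    fib-eq : sign (revAt (p xor s) (g ⁻¹)) * (sign (revAt p g) * v + shiftAt p g) + shiftAt (p xor s) (g ⁻¹) ≡ v
    fib-eq = trans (cong₂ (λ t c → sign t * (sign (revAt p g) * v + shiftAt p g) + c) (revAt-⁻¹ p) (shiftAt-⁻¹ p s))
                   (undo (revAt p g) v (shiftAt p g))

  act-e : ∀ x → act e x ≈ₚ x
  act-e ⟨ false , q , v ⟩ = ≈ₚ⟨ refl , mod-reflexive (unit q) , mod-reflexive (unit v) ⟩
    where
    unit : ∀ q → + 1 * q + + 0 ≡ q
    unit = solve-∀
  act-e ⟨ true , q , v ⟩ = ≈ₚ⟨ refl , mod-reflexive (unit q) , mod-reflexive (unit v) ⟩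
    where
    unit : ∀ q → + 1 * q + + 0 ≡ q
    unit = solve-∀

  private
    module ≈ₚ-Reasoning = SetoidReasoning pointSetoid

  act-injective : ∀ g {x y} → act g x ≈ₚ act g y → x ≈ₚ y
  act-injective g {x} {y} gx≈gy = begin
    x                     ≈⟨ act-⁻¹ g x ⟨
    act (g ⁻¹) (act g x)  ≈⟨ act-cong (≈-refl {g ⁻¹}) gx≈gy ⟩
    act (g ⁻¹) (act g y)  ≈⟨ act-⁻¹ g y ⟩
    y                     ∎
    where open ≈ₚ-Reasoning

  -- The group laws are transported from the action along faithful.
  ∙-cong : ∀ {g g′ k k′} → g ≈ g′ → k ≈ k′ → g ∙ k ≈ g′ ∙ k′
  ∙-cong {g} {g′} {k} {k′} g≈g′ k≈k′ = faithful _ _ λ x → begin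
    act (g ∙ k) x      ≈⟨ act-∙ g k x ⟩
    act k (act g x)    ≈⟨ act-cong k≈k′ (act-cong g≈g′ (≈ₚ-refl {x})) ⟩
    act k′ (act g′ x)  ≈⟨ act-∙ g′ k′ x ⟨
    act (g′ ∙ k′) x    ∎
    where open ≈ₚ-Reasoning

  ∙-assoc : ∀ g k l → (g ∙ k) ∙ l ≈ g ∙ (k ∙ l)
  ∙-assoc g k l = faithful _ _ λ x → begin
    act ((g ∙ k) ∙ l) x     ≈⟨ act-∙ (g ∙ k) l x ⟩
    act l (act (g ∙ k) x)   ≈⟨ act-cong (≈-refl {l}) (act-∙ g k x) ⟩
    act l (act k (act g x)) ≈⟨ act-∙ k l (act g x) ⟨
    act (k ∙ l) (act g x)   ≈⟨ act-∙ g (k ∙ l) x ⟨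
    act (g ∙ (k ∙ l)) x     ∎
    where open ≈ₚ-Reasoning

  ∙-identityˡ : ∀ g → e ∙ g ≈ g
  ∙-identityˡ g = faithful _ _ λ x → ≈ₚ-trans (act-∙ e g x) (act-cong (≈-refl {g}) (act-e x))

  ∙-identityʳ : ∀ g → g ∙ e ≈ g
  ∙-identityʳ g = faithful _ _ λ x → ≈ₚ-trans (act-∙ g e x) (act-e (act g x))

  ∙-inverseʳ : ∀ g → g ∙ g ⁻¹ ≈ e
  ∙-inverseʳ g = faithful _ _ λ x → ≈ₚ-trans (act-∙ g (g ⁻¹) x) (≈ₚ-trans (act-⁻¹ g x) (≈ₚ-sym (act-e x)))

  private
    elementSetoid : Setoid 0ℓ 0ℓ
    elementSetoid = record { isEquivalence = ≈-isEquivalence }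
    module ≈-Reasoning = SetoidReasoning elementSetoid

  ∙-inverseˡ : ∀ g → g ⁻¹ ∙ g ≈ e
  ∙-inverseˡ g = begin
    g ⁻¹ ∙ g                      ≈⟨ ∙-identityʳ (g ⁻¹ ∙ g) ⟨
    g ⁻¹ ∙ g ∙ e                  ≈⟨ ∙-cong (≈-refl {g ⁻¹ ∙ g}) (∙-inverseʳ (g ⁻¹)) ⟨
    g ⁻¹ ∙ g ∙ (g ⁻¹ ∙ g ⁻¹ ⁻¹)   ≈⟨ ∙-assoc (g ⁻¹) g (g ⁻¹ ∙ g ⁻¹ ⁻¹) ⟩
    g ⁻¹ ∙ (g ∙ (g ⁻¹ ∙ g ⁻¹ ⁻¹)) ≈⟨ ∙-cong (≈-refl {g ⁻¹}) (∙-assoc g (g ⁻¹) (g ⁻¹ ⁻¹)) ⟨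
    g ⁻¹ ∙ (g ∙ g ⁻¹ ∙ g ⁻¹ ⁻¹)   ≈⟨ ∙-cong (≈-refl {g ⁻¹}) (∙-cong (∙-inverseʳ g) (≈-refl {g ⁻¹ ⁻¹})) ⟩
    g ⁻¹ ∙ (e ∙ g ⁻¹ ⁻¹)          ≈⟨ ∙-cong (≈-refl {g ⁻¹}) (∙-identityˡ (g ⁻¹ ⁻¹)) ⟩
    g ⁻¹ ∙ g ⁻¹ ⁻¹                ≈⟨ ∙-inverseʳ (g ⁻¹) ⟩
    e                             ∎
    where open ≈-Reasoning

  ⁻¹-cong : ∀ {g g′} → g ≈ g′ → g ⁻¹ ≈ g′ ⁻¹
  ⁻¹-cong {g} {g′} g≈g′ = begin
    g ⁻¹                ≈⟨ ∙-identityʳ (g ⁻¹) ⟨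
    g ⁻¹ ∙ e            ≈⟨ ∙-cong (≈-refl {g ⁻¹}) (∙-inverseʳ g′) ⟨
    g ⁻¹ ∙ (g′ ∙ g′ ⁻¹) ≈⟨ ∙-assoc (g ⁻¹) g′ (g′ ⁻¹) ⟨
    g ⁻¹ ∙ g′ ∙ g′ ⁻¹   ≈⟨ ∙-cong (∙-cong (≈-refl {g ⁻¹}) (≈-sym g≈g′)) (≈-refl {g′ ⁻¹}) ⟩
    g ⁻¹ ∙ g ∙ g′ ⁻¹    ≈⟨ ∙-cong (∙-inverseˡ g) (≈-refl {g′ ⁻¹}) ⟩
    e ∙ g′ ⁻¹           ≈⟨ ∙-identityˡ (g′ ⁻¹) ⟩
    g′ ⁻¹               ∎
    where open ≈-Reasoning

  group : Group 0ℓ 0ℓ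
  group = record
    { Carrier = Elt
    ; _≈_ = _≈_
    ; _∙_ = _∙_
    ; ε = e
    ; _⁻¹ = _⁻¹
    ; isGroup = record
      { isMonoid = record
        { isSemigroup = record
          { isMagma = record { isEquivalence = ≈-isEquivalence ; ∙-cong = ∙-cong }
          ; assoc = ∙-assoc
          }
        ; identity = ∙-identityˡ , ∙-identityʳ
        }
      ; inverse = ∙-inverseˡ , ∙-inverseʳ
      ; ⁻¹-cong = ⁻¹-cong
      }
    }

Conn-snoc : ∀ {N} {gs : List (Fin N → Fin N)} {f g r} → Conn gs f g → r ∈ gs → Conn gs f (r g)
Conn-snoc here         r∈gs = step r∈gs here
Conn-snoc (step p c) r∈gs = step p (Conn-snoc c r∈gs)

Conn-invariant : ∀ {N} {gs : List (Fin N → Fin N)} (P : Fin N → Set) →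
                 (∀ {r f} → r ∈ gs → P f → P (r f)) → ∀ {f g} → Conn gs f g → P f → P g
Conn-invariant P step-P here       Pf = Pf
Conn-invariant P step-P (step p c) Pf = Conn-invariant P step-P c (step-P p Pf)

data Index : Set where
  i₀ i₁ i₂ : Index

module Conjugation (𝒢 : Group 0ℓ 0ℓ) (a : Group.Carrier 𝒢) where

  open Group 𝒢
  open SetoidReasoning setoid

  conj : Carrier → Carrier
  conj x = a \\ (x ∙ a)

  conj-cong : ∀ {x y} → x ≈ y → conj x ≈ conj y
  conj-cong x≈y = ∙-cong refl (∙-cong x≈y refl)

  conj-ε : conj ε ≈ ε
  conj-ε = trans (∙-cong refl (identityˡ a)) (inverseˡ a)

  conj-∙ : ∀ x y → conj x ∙ conj y ≈ conj (x ∙ y)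
  conj-∙ x y = begin
    a ⁻¹ ∙ (x ∙ a) ∙ (a ⁻¹ ∙ (y ∙ a)) ≈⟨ assoc _ _ _ ⟩
    a ⁻¹ ∙ ((x ∙ a) ∙ (a ⁻¹ ∙ (y ∙ a))) ≈⟨ ∙-cong refl (assoc _ _ _) ⟩
    a ⁻¹ ∙ (x ∙ (a ∙ (a ⁻¹ ∙ (y ∙ a)))) ≈⟨ ∙-cong refl (∙-cong refl (assoc _ _ _)) ⟨
    a ⁻¹ ∙ (x ∙ (a ∙ a ⁻¹ ∙ (y ∙ a)))   ≈⟨ ∙-cong refl (∙-cong refl (∙-cong (inverseʳ a) refl)) ⟩
    a ⁻¹ ∙ (x ∙ (ε ∙ (y ∙ a)))          ≈⟨ ∙-cong refl (∙-cong refl (identityˡ _)) ⟩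
    a ⁻¹ ∙ (x ∙ (y ∙ a))                ≈⟨ ∙-cong refl (assoc _ _ _) ⟨
    a ⁻¹ ∙ (x ∙ y ∙ a)                  ∎

  conj-surjective : ∀ y → conj (a ∙ y ∙ a ⁻¹) ≈ y
  conj-surjective y = begin
    a ⁻¹ ∙ (a ∙ y ∙ a ⁻¹ ∙ a)   ≈⟨ ∙-cong refl (assoc _ _ _) ⟩
    a ⁻¹ ∙ (a ∙ y ∙ (a ⁻¹ ∙ a)) ≈⟨ ∙-cong refl (∙-cong refl (inverseˡ a)) ⟩
    a ⁻¹ ∙ (a ∙ y ∙ ε)          ≈⟨ ∙-cong refl (identityʳ _) ⟩
    a ⁻¹ ∙ (a ∙ y)              ≈⟨ assoc _ _ _ ⟨
    a ⁻¹ ∙ a ∙ y                ≈⟨ ∙-cong (inverseˡ a) refl ⟩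
    ε ∙ y                       ≈⟨ identityˡ y ⟩
    y                           ∎

module Words (𝒢 : Group 0ℓ 0ℓ) (ρ : Index → Group.Carrier 𝒢) where

  open Group 𝒢

  rotation : Bool → Carrier
  rotation true  = ρ i₀ ∙ ρ i₁
  rotation false = ρ i₁ ∙ ρ i₂

  rotationWord : List Bool → Carrier
  rotationWord []      = ε
  rotationWord (b ∷ w) = rotation b ∙ rotationWord w

  path : List Index → Carrier
  path []      = ε
  path (i ∷ u) = ρ i ∙ path u

  infixr 8 _^_
  _^_ : Carrier → ℕ → Carrier
  t ^ zero  = ε
  t ^ suc k = t ∙ t ^ k

  ^-comm : ∀ t k → t ^ k ∙ t ≈ t ^ suc k
  ^-comm t zero    = trans (identityˡ t) (sym (identityʳ t))
  ^-comm t (suc k) = trans (assoc t (t ^ k) t) (∙-cong refl (^-comm t k))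

  ^-closedForm : ∀ t (C : ℕ → Carrier) → C 0 ≈ ε → (∀ k → t ∙ C k ≈ C (suc k)) → ∀ k → t ^ k ≈ C k
  ^-closedForm t C base next zero    = sym base
  ^-closedForm t C base next (suc k) = trans (∙-cong refl (^-closedForm t C base next k)) (next k)

  rotationWord-replicate : ∀ b k → rotationWord (replicate k b) ≡ rotation b ^ k
  rotationWord-replicate b zero    = ≡.refl
  rotationWord-replicate b (suc k) = cong (rotation b ∙_) (rotationWord-replicate b k)

  rotationWord-++ : ∀ w w′ → rotationWord (w ++ w′) ≈ rotationWord w ∙ rotationWord w′
  rotationWord-++ []      w′ = sym (identityˡ (rotationWord w′))
  rotationWord-++ (b ∷ w) w′ =
    trans (∙-cong refl (rotationWord-++ w w′)) (sym (assoc (rotation b) (rotationWord w) (rotationWord w′)))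

  HasOrder : Carrier → ℕ → Set
  HasOrder t p = t ^ p ≈ ε × (∀ k → 0 ℕ.< k → k ℕ.< p → ¬ t ^ k ≈ ε)

  rotationPath : List Bool → List Index
  rotationPath []          = []
  rotationPath (true ∷ w)  = i₀ ∷ i₁ ∷ rotationPath w
  rotationPath (false ∷ w) = i₁ ∷ i₂ ∷ rotationPath w

  path-rotationPath : ∀ w → path (rotationPath w) ≈ rotationWord w
  path-rotationPath []          = refl
  path-rotationPath (true ∷ w)  = trans (sym (assoc (ρ i₀) (ρ i₁) _)) (∙-cong refl (path-rotationPath w))
  path-rotationPath (false ∷ w) = trans (sym (assoc (ρ i₁) (ρ i₂) _)) (∙-cong refl (path-rotationPath w))

  path-++ : ∀ u v → path (u ++ v) ≈ path u ∙ path v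
  path-++ []      v = sym (identityˡ (path v))
  path-++ (i ∷ u) v = trans (∙-cong refl (path-++ u v)) (sym (assoc (ρ i) (path u) (path v)))

-- The map whose flags are the elements of a group generated by three involutions ρ₀, ρ₁, ρ₂ with
-- ρ₀ρ₂ = ρ₂ρ₀: r_i is left multiplication by ρ_i, so right multiplications are automorphisms.
module RegularMap (𝒢 : Group 0ℓ 0ℓ) (ρ : Index → Group.Carrier 𝒢) where

  open Group 𝒢
  open Words 𝒢 ρ
  open GroupProperties 𝒢 using (identityˡ-unique; quasigroup)
  open QuasigroupProperties quasigroup using (y≈x\\z)

  module Flags
    {N : ℕ} (encode : Carrier → Fin N) (decode : Fin N → Carrier)
    (encode-cong : ∀ {x y} → x ≈ y → encode x ≡ encode y)
    (decode-encode : ∀ x → decode (encode x) ≈ x)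
    (encode-decode : ∀ f → encode (decode f) ≡ f)
    (ρ-involutive : ∀ i → ρ i ∙ ρ i ≈ ε)
    (ρ-nontrivial : ∀ i → ¬ ρ i ≈ ε)
    (ρ₀ρ₂-comm : ρ i₀ ∙ ρ i₂ ≈ ρ i₂ ∙ ρ i₀)
    (ρ₀ρ₂-nontrivial : ¬ ρ i₀ ∙ ρ i₂ ≈ ε)
    (rotations-generate : ∀ g → ∃ λ w → rotationWord w ≈ g)
    where

    open SetoidReasoning setoid

    -- Opaque, so that iterating them never unfolds nested products of group elements.
    opaque
      leftMul rightMul : Carrier → Fin N → Fin N
      leftMul x f  = encode (x ∙ decode f)
      rightMul y f = encode (decode f ∙ y)

      decode-leftMul : ∀ x f → decode (leftMul x f) ≈ x ∙ decode f
      decode-leftMul x f = decode-encode (x ∙ decode f)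

      decode-rightMul : ∀ y f → decode (rightMul y f) ≈ decode f ∙ y
      decode-rightMul y f = decode-encode (decode f ∙ y)

    decode-injective : ∀ {f g} → decode f ≈ decode g → f ≡ g
    decode-injective {f} {g} f≈g = ≡.trans (≡.sym (encode-decode f)) (≡.trans (encode-cong f≈g) (encode-decode g))

    leftMul-cong : ∀ {x y} f → x ≈ y → leftMul x f ≡ leftMul y f
    leftMul-cong {x} {y} f x≈y = decode-injective (begin
      decode (leftMul x f) ≈⟨ decode-leftMul x f ⟩
      x ∙ decode f         ≈⟨ ∙-cong x≈y refl ⟩
      y ∙ decode f         ≈⟨ decode-leftMul y f ⟨
      decode (leftMul y f) ∎)

    leftMul-∙ : ∀ x y f → leftMul x (leftMul y f) ≡ leftMul (x ∙ y) f
    leftMul-∙ x y f = decode-injective (begin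
      decode (leftMul x (leftMul y f)) ≈⟨ decode-leftMul x _ ⟩
      x ∙ decode (leftMul y f)         ≈⟨ ∙-cong refl (decode-leftMul y f) ⟩
      x ∙ (y ∙ decode f)               ≈⟨ assoc x y (decode f) ⟨
      x ∙ y ∙ decode f                 ≈⟨ decode-leftMul (x ∙ y) f ⟨
      decode (leftMul (x ∙ y) f)       ∎)

    leftMul-ε : ∀ f → leftMul ε f ≡ f
    leftMul-ε f = decode-injective (trans (decode-leftMul ε f) (identityˡ (decode f)))

    leftMul-fixed : ∀ x f → leftMul x f ≡ f → x ≈ ε
    leftMul-fixed x f fixed = identityˡ-unique x (decode f) (begin
      x ∙ decode f          ≈⟨ decode-leftMul x f ⟨
      decode (leftMul x f)  ≡⟨ cong decode fixed ⟩
      decode f              ∎)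

    leftMul-quotient : ∀ f g → leftMul (decode g ∙ decode f ⁻¹) f ≡ g
    leftMul-quotient f g = decode-injective (begin
      decode (leftMul (decode g ∙ decode f ⁻¹) f) ≈⟨ decode-leftMul _ f ⟩
      decode g ∙ decode f ⁻¹ ∙ decode f           ≈⟨ assoc _ _ _ ⟩
      decode g ∙ (decode f ⁻¹ ∙ decode f)         ≈⟨ ∙-cong refl (inverseˡ _) ⟩
      decode g ∙ ε                                ≈⟨ identityʳ _ ⟩
      decode g                                    ∎)

    rightMul-leftMul : ∀ y x f → rightMul y (leftMul x f) ≡ leftMul x (rightMul y f)
    rightMul-leftMul y x f = decode-injective (begin
      decode (rightMul y (leftMul x f)) ≈⟨ decode-rightMul y _ ⟩
      decode (leftMul x f) ∙ y          ≈⟨ ∙-cong (decode-leftMul x f) refl ⟩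
      x ∙ decode f ∙ y                  ≈⟨ assoc x (decode f) y ⟩
      x ∙ (decode f ∙ y)                ≈⟨ ∙-cong refl (decode-rightMul y f) ⟨
      x ∙ decode (rightMul y f)         ≈⟨ decode-leftMul x _ ⟨
      decode (leftMul x (rightMul y f)) ∎)

    rightMul-∙ : ∀ y z f → rightMul z (rightMul y f) ≡ rightMul (y ∙ z) f
    rightMul-∙ y z f = decode-injective (begin
      decode (rightMul z (rightMul y f)) ≈⟨ decode-rightMul z _ ⟩
      decode (rightMul y f) ∙ z          ≈⟨ ∙-cong (decode-rightMul y f) refl ⟩
      decode f ∙ y ∙ z                   ≈⟨ assoc (decode f) y z ⟩
      decode f ∙ (y ∙ z)                 ≈⟨ decode-rightMul (y ∙ z) f ⟨
      decode (rightMul (y ∙ z) f)        ∎)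

    rightMul-cong : ∀ {y z} f → y ≈ z → rightMul y f ≡ rightMul z f
    rightMul-cong {y} {z} f y≈z = decode-injective (begin
      decode (rightMul y f) ≈⟨ decode-rightMul y f ⟩
      decode f ∙ y          ≈⟨ ∙-cong refl y≈z ⟩
      decode f ∙ z          ≈⟨ decode-rightMul z f ⟨
      decode (rightMul z f) ∎)

    rightMul-ε : ∀ f → rightMul ε f ≡ f
    rightMul-ε f = decode-injective (trans (decode-rightMul ε f) (identityʳ (decode f)))

    rightMul-determined : ∀ y z f → rightMul y f ≡ leftMul z f → y ≈ decode f \\ (z ∙ decode f)
    rightMul-determined y z f eq = y≈x\\z (decode f) y (z ∙ decode f) (begin
      decode f ∙ y                 ≈⟨ decode-rightMul y f ⟨
      decode (rightMul y f)        ≡⟨ cong decode eq ⟩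
      decode (leftMul z f)         ≈⟨ decode-leftMul z f ⟩
      z ∙ decode f                 ∎)

    r : Index → Fin N → Fin N
    r i = leftMul (ρ i)

    path⇒Conn : ∀ is {u} f → All (_∈ is) u → Conn (map r is) f (leftMul (path u) f)
    path⇒Conn is f []         = subst (Conn _ f) (≡.sym (leftMul-ε f)) here
    path⇒Conn is f (_∷_ {i} {u} i∈is u∈is) =
      subst (Conn _ f) (leftMul-∙ (ρ i) (path u) f) (Conn-snoc (path⇒Conn is f u∈is) (∈-map⁺ r i∈is))

    Conn⇒path : ∀ is {f g} → Conn (map r is) f g → ∃ λ u → All (_∈ is) u × decode g ≈ path u ∙ decode f
    Conn⇒path is {f} f⇝g = Conn-invariant P step-P f⇝g ([] , [] , sym (identityˡ (decode f)))
      where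
      P : Fin N → Set
      P g = ∃ λ u → All (_∈ is) u × decode g ≈ path u ∙ decode f
      step-P : ∀ {h g} → h ∈ map r is → P g → P (h g)
      step-P {g = g} h∈ (u , u∈is , g≈) with ∈-map⁻ r h∈
      ... | i , i∈is , ≡.refl = i ∷ u , i∈is ∷ u∈is , (begin
        decode (r i g)             ≈⟨ decode-leftMul (ρ i) g ⟩
        ρ i ∙ decode g             ≈⟨ ∙-cong refl g≈ ⟩
        ρ i ∙ (path u ∙ decode f)  ≈⟨ assoc _ _ _ ⟨
        ρ i ∙ path u ∙ decode f    ∎)

    all-indices : List Index
    all-indices = i₀ ∷ i₁ ∷ i₂ ∷ []

    generators : List (Fin N → Fin N)
    generators = map r all-indices

    every-index : ∀ u → All (_∈ all-indices) u
    every-index []       = []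
    every-index (i₀ ∷ u) = here ≡.refl ∷ every-index u
    every-index (i₁ ∷ u) = there (here ≡.refl) ∷ every-index u
    every-index (i₂ ∷ u) = there (there (here ≡.refl)) ∷ every-index u

    connected : ∀ f g → Conn generators f g
    connected f g = subst (Conn generators f) (≡.trans (leftMul-cong f quotient≈path) (leftMul-quotient f g))
                          (path⇒Conn all-indices f (every-index u))
      where
      w = proj₁ (rotations-generate (decode g ∙ decode f ⁻¹))
      u = rotationPath w
      quotient≈path : path u ≈ decode g ∙ decode f ⁻¹
      quotient≈path = trans (path-rotationPath w) (proj₂ (rotations-generate (decode g ∙ decode f ⁻¹)))

    r-involutive : ∀ i f → r i (r i f) ≡ f
    r-involutive i f = ≡.trans (leftMul-∙ (ρ i) (ρ i) f) (≡.trans (leftMul-cong f (ρ-involutive i)) (leftMul-ε f))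

    r-fixedPointFree : ∀ i f → r i f ≢ f
    r-fixedPointFree i f fixed = ρ-nontrivial i (leftMul-fixed (ρ i) f fixed)

    flagMap : Map
    flagMap = record
      { N = N
      ; r₀ = r i₀
      ; r₁ = r i₁
      ; r₂ = r i₂
      ; inv₀ = r-involutive i₀
      ; inv₁ = r-involutive i₁
      ; inv₂ = r-involutive i₂
      ; fpf₀ = r-fixedPointFree i₀
      ; fpf₁ = r-fixedPointFree i₁
      ; fpf₂ = r-fixedPointFree i₂
      ; comm₀₂ = λ f → ≡.trans (leftMul-∙ (ρ i₀) (ρ i₂) f)
                         (≡.trans (leftMul-cong f ρ₀ρ₂-comm) (≡.sym (leftMul-∙ (ρ i₂) (ρ i₀) f)))
      ; fpf₀₂ = λ f fixed → ρ₀ρ₂-nontrivial (leftMul-fixed _ f (≡.trans (≡.sym (leftMul-∙ (ρ i₀) (ρ i₂) f)) fixed))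
      ; connected = connected
      }

    rightMul-isAut : ∀ y → IsAut flagMap (rightMul y)
    rightMul-isAut y f = rightMul-leftMul y (ρ i₀) f , rightMul-leftMul y (ρ i₁) f , rightMul-leftMul y (ρ i₂) f

    isAut⇒rightMul : ∀ φ → IsAut flagMap φ → ∀ f → φ f ≡ rightMul (decode (φ (encode ε))) f
    isAut⇒rightMul φ φ-aut f = Conn-invariant P preserved (connected (encode ε) f) base
      where
      y = decode (φ (encode ε))
      P : Fin N → Set
      P f = φ f ≡ rightMul y f
      commutes : ∀ i f → φ (r i f) ≡ r i (φ f)
      commutes i₀ f = proj₁ (φ-aut f)
      commutes i₁ f = proj₁ (proj₂ (φ-aut f))
      commutes i₂ f = proj₂ (proj₂ (φ-aut f))
      preserved-r : ∀ i {f} → P f → P (r i f)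
      preserved-r i {f} Pf = ≡.trans (commutes i f) (≡.trans (cong (r i) Pf) (≡.sym (rightMul-leftMul y (ρ i) f)))
      preserved : ∀ {h f} → h ∈ generators → P f → P (h f)
      preserved (here ≡.refl)                 = preserved-r i₀
      preserved (there (here ≡.refl))         = preserved-r i₁
      preserved (there (there (here ≡.refl))) = preserved-r i₂
      base : P (encode ε)
      base = decode-injective (begin
        decode (φ (encode ε))          ≈⟨ identityˡ y ⟨
        ε ∙ y                          ≈⟨ ∙-cong (decode-encode ε) refl ⟨
        decode (encode ε) ∙ y          ≈⟨ decode-rightMul y (encode ε) ⟨
        decode (rightMul y (encode ε)) ∎)

    reflexible : Reflexible flagMap
    reflexible f g = rightMul (decode f ⁻¹ ∙ decode g) , rightMul-isAut _ , decode-injective (begin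
      decode (rightMul (decode f ⁻¹ ∙ decode g) f) ≈⟨ decode-rightMul _ f ⟩
      decode f ∙ (decode f ⁻¹ ∙ decode g)          ≈⟨ assoc _ _ _ ⟨
      decode f ∙ decode f ⁻¹ ∙ decode g            ≈⟨ ∙-cong (inverseʳ _) refl ⟩
      ε ∙ decode g                                 ≈⟨ identityˡ _ ⟩
      decode g                                     ∎)

    iter-leftMul : ∀ t k f → iter k (leftMul t) f ≡ leftMul (t ^ k) f
    iter-leftMul t zero    f = ≡.sym (leftMul-ε f)
    iter-leftMul t (suc k) f = ≡.trans (iter-leftMul t k (leftMul t f))
                                 (≡.trans (leftMul-∙ (t ^ k) t f) (leftMul-cong f (^-comm t k)))

    iter-leftMul′ : ∀ {s} t → (∀ f → s f ≡ leftMul t f) → ∀ k f → iter k s f ≡ leftMul (t ^ k) f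
    iter-leftMul′ {s} t s≗t k f = ≡.trans (iter-cong k f) (iter-leftMul t k f)
      where
      iter-cong : ∀ k f → iter k s f ≡ iter k (leftMul t) f
      iter-cong zero    f = ≡.refl
      iter-cong (suc k) f = ≡.trans (iter-cong k (s f)) (cong (iter k (leftMul t)) (s≗t f))

    exactOrder : ∀ {s} t p → (∀ f → s f ≡ leftMul t f) → HasOrder t p → ExactOrder flagMap s p
    exactOrder {s} t p s≗t (tᵖ≈ε , tᵏ≉ε) f = periodic , aperiodic
      where
      periodic  = ≡.trans (iter-leftMul′ t s≗t p f) (≡.trans (leftMul-cong f tᵖ≈ε) (leftMul-ε f))
      aperiodic = λ k 0<k k<p fixed → tᵏ≉ε k 0<k k<p (leftMul-fixed (t ^ k) f (≡.trans (≡.sym (iter-leftMul′ t s≗t k f)) fixed))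

    hasType : ∀ {p q} → HasOrder (ρ i₁ ∙ ρ i₀) p → HasOrder (ρ i₁ ∙ ρ i₂) q → HasType flagMap p q
    hasType {p} {q} face vertex =
      exactOrder _ p (λ f → leftMul-∙ (ρ i₁) (ρ i₀) f) face , exactOrder _ q (λ f → leftMul-∙ (ρ i₁) (ρ i₂) f) vertex

    leftMul-rotationWord : ∀ b w f → leftMul (rotationWord (b ∷ w)) f ≡ leftMul (rotation b) (leftMul (rotationWord w) f)
    leftMul-rotationWord b w f = ≡.sym (leftMul-∙ (rotation b) (rotationWord w) f)

    -- A proper 2-colouring of the flags is preserved by every rotation word, in particular by ρ₁.
    nonOrientable : NonOrientable flagMap
    nonOrientable (col , proper) =
      proj₁ (proj₂ (proper f)) (≡.trans (cong col (leftMul-cong f (sym ρ₁≈w))) (rotations-preserve w f))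
      where
      f = encode ε
      w = proj₁ (rotations-generate (ρ i₁))
      ρ₁≈w = proj₂ (rotations-generate (ρ i₁))
      flips : ∀ i f → col (r i f) ≡ not (col f)
      flips i₀ f = ¬-not (proj₁ (proper f))
      flips i₁ f = ¬-not (proj₁ (proj₂ (proper f)))
      flips i₂ f = ¬-not (proj₂ (proj₂ (proper f)))
      flips-twice : ∀ i j f → col (r i (r j f)) ≡ col f
      flips-twice i j f = ≡.trans (flips i (r j f)) (≡.trans (cong not (flips j f)) (not-involutive (col f)))
      rotation-preserves : ∀ b f → col (leftMul (rotation b) f) ≡ col f
      rotation-preserves true  f = ≡.trans (cong col (≡.sym (leftMul-∙ (ρ i₀) (ρ i₁) f))) (flips-twice i₀ i₁ f)
      rotation-preserves false f = ≡.trans (cong col (≡.sym (leftMul-∙ (ρ i₁) (ρ i₂) f))) (flips-twice i₁ i₂ f)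
      rotations-preserve : ∀ w f → col (leftMul (rotationWord w) f) ≡ col f
      rotations-preserve []      f = cong col (leftMul-ε f)
      rotations-preserve (b ∷ w) f = ≡.trans (cong col (leftMul-rotationWord b w f))
                                       (≡.trans (rotation-preserves b _) (rotations-preserve w f))

    distinguished⇒evalF : ∀ f₀ R S → Distinguished flagMap f₀ R S →
      ∀ w f → evalF flagMap R S w f ≡ rightMul (Conjugation.conj 𝒢 (decode f₀) (rotationWord w)) f
    distinguished⇒evalF f₀ R S (R-aut , S-aut , R-base , S-base) = go
      where
      open Conjugation 𝒢 (decode f₀)
      as-rightMul : ∀ φ b → IsAut flagMap φ → φ f₀ ≡ leftMul (rotation b) f₀ → ∀ f → φ f ≡ rightMul (conj (rotation b)) f
      as-rightMul φ b φ-aut base f = ≡.trans (isAut⇒rightMul φ φ-aut f) (rightMul-cong f (rightMul-determined _ _ f₀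
        (≡.trans (≡.sym (isAut⇒rightMul φ φ-aut f₀)) base)))
      generator : ∀ b f → (if b then R f else S f) ≡ rightMul (conj (rotation b)) f
      generator true  = as-rightMul R true  R-aut (≡.trans R-base (leftMul-∙ (ρ i₀) (ρ i₁) f₀))
      generator false = as-rightMul S false S-aut (≡.trans S-base (leftMul-∙ (ρ i₁) (ρ i₂) f₀))
      go : ∀ w f → evalF flagMap R S w f ≡ rightMul (conj (rotationWord w)) f
      go []      f = ≡.sym (≡.trans (rightMul-cong f conj-ε) (rightMul-ε f))
      go (b ∷ w) f = ≡.trans (go w _) (≡.trans (cong (rightMul _) (generator b f))
                       (≡.trans (rightMul-∙ _ _ f) (rightMul-cong f (conj-∙ _ _))))

module TheGroup (a b : ℕ) where

  import Data.Nat.Properties as ℕ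
  import Data.Nat.DivMod as ℕ
  open import Data.Integer using (ℤ; +_; _+_; _*_; -_; _-_; _%ℕ_)
  open import Data.Integer.Properties using (pos-+; pos-*; neg-involutive)
  open import Data.Integer.DivMod using (n%ℕd<d)
  open import Data.Integer.Tactic.RingSolver using (solve-∀)
  open import Data.Nat.Tactic.RingSolver using () renaming (solve-∀ to ℕ-solve-∀)
  open import Data.Bool using (Bool; true; false; not; _xor_; _∧_; if_then_else_)
  open import Data.Bool.Properties using (not-involutive; xor-identityʳ; xor-same)
  open import Data.List using (List; []; _∷_; _++_; replicate)
  import Data.List.Relation.Unary.All.Properties as All
  open import Data.Product using (∃; _×_; _,_; proj₁; proj₂)
  open import Data.Sum using (_⊎_; inj₁; inj₂; [_,_]′)
  open import Data.Empty using (⊥; ⊥-elim)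
  open import Function using (_∘_)
  open import Tactic.RingSolver using () renaming (solve-∀ to solve-∀-in)
  open import Relation.Binary.PropositionalEquality

  h m : ℕ
  h = suc (suc (suc (a ℕ.+ a)))
  m = suc (suc (suc (b ℕ.+ b)))

  2<h : 2 ℕ.< h
  2<h = ℕ.s≤s (ℕ.s≤s (ℕ.s≤s ℕ.z≤n))

  2<m : 2 ℕ.< m
  2<m = ℕ.s≤s (ℕ.s≤s (ℕ.s≤s ℕ.z≤n))

  open AffineGroup h m 2<h 2<m public

  -- Chosen so that ρ₀ρ₁ and ρ₁ρ₂ are σ₁ and σ₂ in the coordinates of Relabelling (Φ-σ₁, Φ-σ₂).
  ρ : Index → Elt
  ρ i₀ = mk true  true  (- + 1) true  (+ 0) (+ 0)
  ρ i₁ = mk true  false (+ 0)   false (+ 0) (+ 0)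
  ρ i₂ = mk false false (+ 0)   true  (+ 2) (- + 2)

  open Words group ρ public

  τ : Elt
  τ = ρ i₁ ∙ ρ i₀

  ρ-involutive : ∀ i → ρ i ∙ ρ i ≈ e
  ρ-involutive i₀ = ≈-refl
  ρ-involutive i₁ = ≈-refl
  ρ-involutive i₂ = ≈-refl

  ρ-nontrivial : ∀ i → ¬ ρ i ≈ e
  ρ-nontrivial i₀ ()
  ρ-nontrivial i₁ ()
  ρ-nontrivial i₂ ()

  ρ₀ρ₂-comm : ρ i₀ ∙ ρ i₂ ≈ ρ i₂ ∙ ρ i₀
  ρ₀ρ₂-comm = ≈-refl

  ρ₀ρ₂-nontrivial : ¬ ρ i₀ ∙ ρ i₂ ≈ e
  ρ₀ρ₂-nontrivial ()

  Generated : Elt → Set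
  Generated g = ∃ λ w → rotationWord w ≈ g

  generated-∙ : ∀ {g k} → Generated g → Generated k → Generated (g ∙ k)
  generated-∙ (w , w≈g) (w′ , w′≈k) = w ++ w′ , ≈-trans (rotationWord-++ w w′) (∙-cong w≈g w′≈k)

  generated-resp : ∀ {g k} → g ≈ k → Generated g → Generated k
  generated-resp g≈k (w , w≈g) = w , ≈-trans w≈g g≈k

  private
    vanish : ∀ s → s * + 0 + + 0 ≡ + 0
    vanish = solve-∀

  σ₁^ : ℕ → Elt
  σ₁^ k = mk false (odd k) (+ k) (oddHalf k) (+ 0) (+ 0)

  σ₁^-closedForm : ∀ k → rotation true ^ k ≈ σ₁^ k
  σ₁^-closedForm = ^-closedForm (rotation true) σ₁^ ≈-refl λ k →
    ≈⟨ refl , refl , mod-refl , swap-xor (odd k) (oddHalf k)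
     , mod-reflexive (vanish (sign (odd k xor oddHalf k))) , mod-reflexive (vanish (sign (oddHalf k))) ⟩
    where
    swap-xor : ∀ p t → (p xor t) xor false ≡ t xor p
    swap-xor = solve-∀-in 𝔽₂

  σ₂^ : ℕ → Elt
  σ₂^ k = mk (odd k) false (+ 0) (odd k) (if odd k then + 2 else + 0) (- (+ 2 * + k))

  σ₂^-closedForm : ∀ k → rotation false ^ k ≈ σ₂^ k
  σ₂^-closedForm = ^-closedForm (rotation false) σ₂^ ≈-refl next
    where
    advance : ∀ k → - + 2 + - (+ 2 * + k) ≡ - (+ 2 * + suc k)
    advance k = trans (lemma (+ k)) (cong (λ x → - (+ 2 * x)) (pos-+ 1 k))
      where
      lemma : ∀ x → - + 2 + - (+ 2 * x) ≡ - (+ 2 * (+ 1 + x))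
      lemma = solve-∀
    next : ∀ k → rotation false ∙ σ₂^ k ≈ σ₂^ (suc k)
    next k with odd k
    ... | false = ≈⟨ refl , refl , mod-refl , refl , mod-refl , mod-reflexive (advance k) ⟩
    ... | true  = ≈⟨ refl , refl , mod-refl , refl , mod-refl , mod-reflexive (advance k) ⟩

  τ^ : ℕ → Elt
  τ^ k = mk false (odd k) (- + k) (oddHalf (suc k)) (+ 0) (+ 0)

  τ^-closedForm : ∀ k → τ ^ k ≈ τ^ k
  τ^-closedForm = ^-closedForm τ τ^ ≈-refl λ k →
    ≈⟨ refl , refl , mod-reflexive (advance k) , flip (odd k) (oddHalf (suc k))
     , mod-reflexive (vanish (sign (odd k xor oddHalf (suc k)))) , mod-reflexive (vanish (sign (oddHalf (suc k)))) ⟩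
    where
    advance : ∀ k → - + 1 + - + k ≡ - + suc k
    advance k = trans (lemma (+ k)) (cong -_ (pos-+ 1 k))
      where
      lemma : ∀ x → - + 1 + - x ≡ - (+ 1 + x)
      lemma = solve-∀
    flip : ∀ p t → (p xor t) xor true ≡ t xor (true xor p)
    flip = solve-∀-in 𝔽₂

  odd-h : odd h ≡ true
  odd-h = cong (λ x → not (not (not x))) (odd-double a)

  oddHalf-2h : oddHalf (h ℕ.+ h) ≡ true
  oddHalf-2h = trans (oddHalf-+ h h) (trans (cong (λ x → (oddHalf h xor oddHalf h) xor (x ∧ x)) odd-h) (cancel (oddHalf h)))
    where
    cancel : ∀ x → (x xor x) xor true ≡ true
    cancel = solve-∀-in 𝔽₂

  addIf : Bool → ℕ → ℕ → ℕ
  addIf false d k = k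
  addIf true  d k = k ℕ.+ d

  addIf-mod : ∀ c {d} k → + d ≡ + 0 [mod h ] → + addIf c d k ≡ + k [mod h ]
  addIf-mod false k _ = mod-refl
  addIf-mod true {d} k d≡0 = mod-trans (mod-reflexive (pos-+ k d)) (mod-trans (mod-+ˡ (+ k) d≡0) (mod-reflexive (unit (+ k))))
    where
    unit : ∀ x → x + + 0 ≡ x
    unit = solve-∀

  h≡0 : + h ≡ + 0 [mod h ]
  h≡0 = + 1 , once (+ h)
    where
    once : ∀ x → x ≡ + 0 + + 1 * x
    once = solve-∀

  2h≡0 : + (h ℕ.+ h) ≡ + 0 [mod h ]
  2h≡0 = + 2 , trans (pos-+ h h) (twice (+ h))
    where
    twice : ∀ x → x + x ≡ + 0 + + 2 * x
    twice = solve-∀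

  odd-addIf-h : ∀ c k → odd (addIf c h k) ≡ odd k xor c
  odd-addIf-h false k = sym (xor-identityʳ (odd k))
  odd-addIf-h true k = trans (odd-+ k h) (cong (odd k xor_) odd-h)

  odd-addIf-2h : ∀ c k → odd (addIf c (h ℕ.+ h) k) ≡ odd k
  odd-addIf-2h false k = refl
  odd-addIf-2h true  k = trans (odd-+ k (h ℕ.+ h)) (trans (cong (odd k xor_) (odd-double h)) (xor-identityʳ (odd k)))

  oddHalf-addIf-2h : ∀ c k → oddHalf (addIf c (h ℕ.+ h) k) ≡ oddHalf k xor c
  oddHalf-addIf-2h false k = sym (xor-identityʳ (oddHalf k))
  oddHalf-addIf-2h true k =
    trans (oddHalf-+ k (h ℕ.+ h)) (trans (cong₂ (λ x y → (oddHalf k xor x) xor (odd k ∧ y)) oddHalf-2h (odd-double h))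
      (simplify (oddHalf k) (odd k)))
    where
    simplify : ∀ x y → (x xor true) xor (y ∧ false) ≡ x xor true
    simplify = solve-∀-in 𝔽₂

  -- crt p q is the t < 2h with t ≡ p (mod 2) and t ≡ q (mod h).
  crt : Bool → ℤ → ℕ
  crt p q = addIf (odd (q %ℕ h) xor p) h (q %ℕ h)

  odd-crt : ∀ p q → odd (crt p q) ≡ p
  odd-crt p q = trans (odd-addIf-h (odd r xor p) r) (cancel (odd r) p)
    where
    r = q %ℕ h
    cancel : ∀ x p → x xor (x xor p) ≡ p
    cancel = solve-∀-in 𝔽₂

  crt-mod : ∀ p q → + crt p q ≡ q [mod h ]
  crt-mod p q = mod-trans (addIf-mod (odd (q %ℕ h) xor p) (q %ℕ h) h≡0) (mod-sym (mod-%ℕ h q))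

  crt-< : ∀ p q → crt p q ℕ.< h ℕ.+ h
  crt-< p q = bound (odd (q %ℕ h) xor p) (n%ℕd<d q h)
    where
    bound : ∀ c {r} → r ℕ.< h → addIf c h r ℕ.< h ℕ.+ h
    bound false r<h = ℕ.<-≤-trans r<h (ℕ.m≤m+n h h)
    bound true  r<h = ℕ.+-monoˡ-< h r<h

  crt-cong : ∀ {p p′ q q′} → p ≡ p′ → q ≡ q′ [mod h ] → crt p q ≡ crt p′ q′
  crt-cong {p} refl q≡ = cong (λ r → addIf (odd r xor p) h r) (%ℕ-cong h q≡)

  crt-unique : ∀ t → t ℕ.< h ℕ.+ h → crt (odd t) (+ t) ≡ t
  crt-unique t t<2h = [ small , large ]′ (ℕ.<-≤-connex t h)
    where
    cancel′ : ∀ x → x xor (x xor true) ≡ true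
    cancel′ = solve-∀-in 𝔽₂
    small : t ℕ.< h → crt (odd t) (+ t) ≡ t
    small t<h = trans (cong (λ r → addIf (odd r xor odd t) h r) (ℕ.m<n⇒m%n≡m t<h)) (cong (λ c → addIf c h t) (xor-same (odd t)))
    large : h ℕ.≤ t → crt (odd t) (+ t) ≡ t
    large h≤t = trans (cong (λ r → addIf (odd r xor odd t) h r) t%h≡t′)
                  (trans (cong (λ c → addIf c h t′) parities) t′+h≡t)
      where
      t′ = t ℕ.∸ h
      t′+h≡t : t′ ℕ.+ h ≡ t
      t′+h≡t = ℕ.m∸n+n≡m h≤t
      t′<h : t′ ℕ.< h
      t′<h = ℕ.+-cancelʳ-< h t′ h (subst (ℕ._< h ℕ.+ h) (sym t′+h≡t) t<2h)
      t%h≡t′ : t ℕ.% h ≡ t′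
      t%h≡t′ = trans (cong (ℕ._% h) (sym t′+h≡t)) (trans (ℕ.[m+n]%n≡m%n t′ h) (ℕ.m<n⇒m%n≡m t′<h))
      parities : odd t′ xor odd t ≡ true
      parities = trans (cong (λ x → odd t′ xor odd x) (sym t′+h≡t))
                       (trans (cong (odd t′ xor_) (odd-addIf-h true t′)) (cancel′ (odd t′)))

  -- Since h is odd, k mod 4h is determined by k mod 2, k mod h and ⌊k/2⌋ mod 2.
  exponent : ∀ p q t → ∃ λ k → odd k ≡ p × (+ k ≡ q [mod h ]) × oddHalf k ≡ t
  exponent p q t = addIf c (h ℕ.+ h) k₁
                 , trans (odd-addIf-2h c k₁) (odd-crt p q)
                 , mod-trans (addIf-mod c k₁ 2h≡0) (crt-mod p q)
                 , trans (oddHalf-addIf-2h c k₁) (cancel (oddHalf k₁) t)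
    where
    k₁ = crt p q
    c = oddHalf k₁ xor t
    cancel : ∀ x t → x xor (x xor t) ≡ t
    cancel = solve-∀-in 𝔽₂

  -- 4 · quarter = 8 (b + 1) (b + 2)² ≡ -1 (mod 2b + 3).
  quarter : ℕ
  quarter = 2 ℕ.* suc b ℕ.* suc (suc b) ℕ.* suc (suc b)

  quarter-inverse : ∀ x → x ≡ - + quarter * (+ 4 * x) [mod m ]
  quarter-inverse x = x * (+ 4 * B * B + + 14 * B + + 11)
                    , trans (identity x B)
                        (cong (λ q → - q * (+ 4 * x) + x * (+ 4 * B * B + + 14 * B + + 11) * + m) (sym pos-quarter))
    where
    B = + b
    identity : ∀ x B → x ≡ - (+ 2 * (+ 1 + B) * (+ 2 + B) * (+ 2 + B)) * (+ 4 * x)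
                           + x * (+ 4 * B * B + + 14 * B + + 11) * (+ 3 + (B + B))
    identity = solve-∀
    pos-quarter : + quarter ≡ + 2 * (+ 1 + B) * (+ 2 + B) * (+ 2 + B)
    pos-quarter = trans (pos-* (2 ℕ.* suc b ℕ.* suc (suc b)) (suc (suc b)))
                    (cong (_* + suc (suc b)) (trans (pos-* (2 ℕ.* suc b) (suc (suc b))) (cong (_* + suc (suc b)) (pos-* 2 (suc b)))))

  four-cancel : ∀ x → + 4 * x ≡ + 0 [mod m ] → x ≡ + 0 [mod m ]
  four-cancel x 4x≡0 =
    mod-trans (quarter-inverse x) (mod-trans (mod-*ˡ (- + quarter) 4x≡0) (mod-reflexive (annihilate (- + quarter))))
    where
    annihilate : ∀ y → y * + 0 ≡ + 0
    annihilate = solve-∀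

  translation : ℤ → Elt
  translation c = mk false false (+ 0) false (+ 0) c

  translationWord : ℤ → List Bool
  translationWord c = replicate (L ℕ.+ L) false
    where L = (c %ℕ m) ℕ.* quarter

  translationWord-≈ : ∀ c → rotationWord (translationWord c) ≈ translation c
  translationWord-≈ c = ≈-trans (≈-reflexive (rotationWord-replicate false (L ℕ.+ L)))
    (≈-trans (σ₂^-closedForm (L ℕ.+ L))
      ≈⟨ odd-double L , refl , mod-refl , odd-double L
       , mod-reflexive (cong (λ c → if c then + 2 else + 0) (odd-double L)) , shift₁≡ ⟩)
    where
    r = c %ℕ m
    L = r ℕ.* quarter
    expand : - (+ 2 * + (L ℕ.+ L)) ≡ - + quarter * (+ 4 * + r)
    expand = trans (cong (λ x → - (+ 2 * x)) (trans (pos-+ L L) (cong₂ _+_ (pos-* r quarter) (pos-* r quarter))))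
                   (identity (+ r) (+ quarter))
      where
      identity : ∀ r q → - (+ 2 * (r * q + r * q)) ≡ - q * (+ 4 * r)
      identity = solve-∀
    shift₁≡ : - (+ 2 * + (L ℕ.+ L)) ≡ c [mod m ]
    shift₁≡ = mod-trans (mod-reflexive expand) (mod-trans (mod-sym (quarter-inverse (+ r))) (mod-sym (mod-%ℕ m c)))

  top-generated : ∀ r p q η → ∃ λ d₀ → ∃ λ d₁ → Generated (mk r p q η d₀ d₁)
  top-generated false p q η =
    let k , odd-k , k≡q , half-k = exponent p q η in
    + 0 , + 0 , replicate k true , ≈-trans (≈-reflexive (rotationWord-replicate true k))
                                     (≈-trans (σ₁^-closedForm k) ≈⟨ refl , odd-k , k≡q , half-k , mod-refl , mod-refl ⟩)
  top-generated true p q η =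
    let k , odd-k , k≡q , half-k = exponent p q (not η) in
    shift₀ (rotation false ∙ σ₁^ k) , shift₁ (rotation false ∙ σ₁^ k) , false ∷ replicate k true ,
    ≈-trans (∙-cong (≈-refl {rotation false}) (≈-trans (≈-reflexive (rotationWord-replicate true k)) (σ₁^-closedForm k)))
            ≈⟨ refl , odd-k , k≡q , flip (oddHalf k) η half-k , mod-refl , mod-refl ⟩
    where
    flip : ∀ x η → x ≡ not η → x xor true ≡ η
    flip _ false refl = refl
    flip _ true  refl = refl

  private
    zero-shift : ∀ s x → s * + 0 + x ≡ x
    zero-shift = solve-∀

  translation-∙ : ∀ c A → translation c ∙ A ≈ mk (rev A) (swap A) (shift A) (rev₀ A) (shift₀ A) (sign (revAt true A) * c + shift₁ A)
  translation-∙ c A = ≈⟨ refl , refl , mod-reflexive (zero-shift (sign (rev A)) (shift A)) , xor-identityʳ (rev₀ A)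
                       , mod-reflexive (zero-shift (sign (rev₀ A)) (shift₀ A)) , mod-refl ⟩

  σ₁-∙ : ∀ A → rotation true ∙ A ≈ mk (rev A) (not (swap A)) (sign (rev A) + shift A) (revAt true A) (shift₁ A) (shift₀ A)
  σ₁-∙ A = ≈⟨ refl , refl , mod-reflexive (one-shift (sign (rev A)) (shift A)) , xor-identityʳ (revAt true A)
            , mod-reflexive (zero-shift (sign (revAt true A)) (shift₁ A)) , mod-reflexive (zero-shift (sign (rev₀ A)) (shift₀ A)) ⟩
    where
    one-shift : ∀ s x → s * + 1 + x ≡ s + x
    one-shift = solve-∀

  undo-sign : ∀ s x d → sign s * (sign s * (x - d)) + d ≡ x
  undo-sign s x d = trans (cong (_+ d) (sign-involutive s (x - d))) (restore x d)
    where
    restore : ∀ x d → x - d + d ≡ x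
    restore = solve-∀

  translation-generated : ∀ c → Generated (translation c)
  translation-generated c = translationWord c , translationWord-≈ c

  -- g = t(c₁) σ₁ t(c₀) D, where t translates the fibre over odd points, σ₁ exchanges the two
  -- fibre translations, and D = σ₁ᵏ or σ₂σ₁ᵏ has the rev, swap, shift and rev₀ required by g.
  rotations-generate : ∀ g → Generated g
  rotations-generate g@(mk r p q η x₀ x₁) =
    let d₀ , d₁ , D-generated = top-generated r (not p) (q - sign r) (η xor (r xor not p)) in
    generated-resp (decompose d₀ d₁)
      (generated-∙ (translation-generated (sign (revAt true g) * (x₁ - d₀)))
        (generated-∙ (true ∷ [] , ∙-identityʳ (rotation true))
          (generated-∙ (translation-generated (sign η * (x₀ - d₁))) D-generated)))
    where
    cancel : ∀ r p η → (r xor p) xor (η xor (r xor p)) ≡ η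
    cancel = solve-∀-in 𝔽₂
    decompose : ∀ d₀ d₁ → let D = mk r (not p) (q - sign r) (η xor (r xor not p)) d₀ d₁ in
                translation (sign (revAt true g) * (x₁ - d₀)) ∙ (rotation true ∙ (translation (sign η * (x₀ - d₁)) ∙ D)) ≈ g
    decompose d₀ d₁ = begin
      translation c₁ ∙ (rotation true ∙ (translation c₀ ∙ D))
        ≈⟨ ∙-cong (≈-refl {translation c₁}) (∙-cong (≈-refl {rotation true}) (translation-∙ c₀ D)) ⟩
      translation c₁ ∙ (rotation true ∙ A₁)
        ≈⟨ ∙-cong (≈-refl {translation c₁}) (σ₁-∙ A₁) ⟩
      translation c₁ ∙ A₂
        ≈⟨ translation-∙ c₁ A₂ ⟩
      mk r (not (not p)) (sign r + (q - sign r)) (revAt true A₁) (shift₁ A₁) (sign (revAt true A₂) * c₁ + d₀)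
        ≈⟨ ≈⟨ refl , not-involutive p , mod-reflexive (restore (sign r) q) , revAt-D
            , mod-reflexive (trans (cong (λ s → sign s * c₀ + d₁) revAt-D) (undo-sign η x₀ d₁))
            , mod-reflexive (trans (cong (λ s → sign s * c₁ + d₀) revAt-A₂) (undo-sign (revAt true g) x₁ d₀)) ⟩ ⟩
      g ∎
      where
      open SetoidReasoning (Group.setoid group)
      D = mk r (not p) (q - sign r) (η xor (r xor not p)) d₀ d₁
      c₀ = sign η * (x₀ - d₁)
      c₁ = sign (revAt true g) * (x₁ - d₀)
      A₁ = mk r (not p) (q - sign r) (η xor (r xor not p)) d₀ (sign (revAt true D) * c₀ + d₁)
      A₂ = mk r (not (not p)) (sign r + (q - sign r)) (revAt true A₁) (shift₁ A₁) d₀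
      revAt-D : revAt true D ≡ η
      revAt-D = cancel r (not p) η
      revAt-A₂ : revAt true A₂ ≡ revAt true g
      revAt-A₂ = cong₂ (λ p′ s → (r xor p′) xor s) (not-involutive p) revAt-D
      restore : ∀ s q → s + (q - s) ≡ q
      restore = solve-∀

  -- Stabilisers of the base vertex and of the base arc
  v₀ u₀ : Point
  v₀ = ⟨ false , + 0 , + 1 ⟩
  u₀ = ⟨ true , - + 1 , - + 1 ⟩

  act-ρ₀-v₀ : act (ρ i₀) v₀ ≈ₚ u₀
  act-ρ₀-v₀ = ≈ₚ-refl

  private
    rotationPath-s₂-only : ∀ k → All (_∈ i₁ ∷ i₂ ∷ []) (rotationPath (replicate k false))
    rotationPath-s₂-only zero    = []
    rotationPath-s₂-only (suc k) = here refl ∷ there (here refl) ∷ rotationPath-s₂-only k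

    stabiliserPath : Bool → Bool → List Index
    stabiliserPath false false = []
    stabiliserPath true  false = i₁ ∷ []
    stabiliserPath false true  = i₂ ∷ []
    stabiliserPath true  true  = i₁ ∷ i₂ ∷ []

    stabiliserPath-s₂-only : ∀ r η → All (_∈ i₁ ∷ i₂ ∷ []) (stabiliserPath r η)
    stabiliserPath-s₂-only false false = []
    stabiliserPath-s₂-only true  false = here refl ∷ []
    stabiliserPath-s₂-only false true  = there (here refl) ∷ []
    stabiliserPath-s₂-only true  true  = here refl ∷ there (here refl) ∷ []

    stabiliserPath-≈ : ∀ r η → path (stabiliserPath r η) ≈ mk r false (+ 0) η (+ 1 - sign η) (- (+ 1 - sign η))
    stabiliserPath-≈ false false = ≈-refl
    stabiliserPath-≈ true  false = ≈-refl
    stabiliserPath-≈ false true  = ≈-refl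
    stabiliserPath-≈ true  true  = ≈-refl

  stabiliser-v₀ : ∀ k → act k v₀ ≈ₚ v₀ → ∃ λ u → All (_∈ i₁ ∷ i₂ ∷ []) u × path u ≈ k
  stabiliser-v₀ k@(mk r false q η x₀ x₁) ≈ₚ⟨ refl , cyc≡ , fib≡ ⟩ =
      rotationPath (translationWord c) ++ stabiliserPath r η
    , All.++⁺ (rotationPath-s₂-only _) (stabiliserPath-s₂-only r η)
    , (begin
      path (rotationPath (translationWord c) ++ stabiliserPath r η)
        ≈⟨ path-++ (rotationPath (translationWord c)) (stabiliserPath r η) ⟩
      path (rotationPath (translationWord c)) ∙ path (stabiliserPath r η)
        ≈⟨ ∙-cong (≈-trans (path-rotationPath (translationWord c)) (translationWord-≈ c)) (stabiliserPath-≈ r η) ⟩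
      translation c ∙ D
        ≈⟨ translation-∙ c D ⟩
      mk r false (+ 0) η (+ 1 - sign η) (sign (revAt true D) * c + - (+ 1 - sign η))
        ≈⟨ ≈⟨ refl , refl , shift≡ , refl , shift₀≡ , mod-reflexive (undo-sign (revAt true D) x₁ (- (+ 1 - sign η))) ⟩ ⟩
      k ∎)
    where
    open SetoidReasoning (Group.setoid group)
    D = mk r false (+ 0) η (+ 1 - sign η) (- (+ 1 - sign η))
    c = sign (revAt true D) * (x₁ - - (+ 1 - sign η))
    shift≡ : + 0 ≡ q [mod h ]
    shift≡ = mod-sym (mod-trans (mod-reflexive (sym (zero-shift (sign r) q))) cyc≡)
    shift₀≡ : + 1 - sign η ≡ x₀ [mod m ]
    shift₀≡ = mod-sym (mod-isolate (sign η) (mod-trans (mod-reflexive (one-shift (sign η) x₀)) fib≡))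
      where
      one-shift : ∀ s x → s + x ≡ s * + 1 + x
      one-shift = solve-∀

  private
    fixes-v₀-shift : ∀ k → swap k ≡ false → act k v₀ ≈ₚ v₀ → shift k ≡ + 0 [mod h ]
    fixes-v₀-shift (mk r false q _ _ _) refl ≈ₚ⟨ _ , cyc≡ , _ ⟩ = mod-trans (mod-reflexive (sym (zero-shift (sign r) q))) cyc≡

    fixes-u₀-rev : ∀ k → swap k ≡ false → shift k ≡ + 0 [mod h ] → act k u₀ ≈ₚ u₀ → rev k ≡ false
    fixes-u₀-rev (mk r false q _ _ _) refl q≡0 ≈ₚ⟨ _ , cyc≡ , _ ⟩ =
      sign-injective 2<h (mod-trans (mod-reflexive (sym (solve (sign r) q))) (mod-+ (mod-neg cyc≡) q≡0))
      where
      solve : ∀ s q → - (s * - + 1 + q) + q ≡ s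
      solve = solve-∀

  stabiliser-arc : ∀ k → act k v₀ ≈ₚ v₀ → act k u₀ ≈ₚ u₀ → k ≈ e ⊎ k ≈ ρ i₂
  stabiliser-arc k@(mk true false _ _ _ _) v-fixed u-fixed
    with () ← fixes-u₀-rev k refl (fixes-v₀-shift k refl v-fixed) u-fixed
  stabiliser-arc k@(mk false false _ false _ _) v-fixed@(≈ₚ⟨ _ , _ , fib≡ ⟩) ≈ₚ⟨ _ , _ , fib≡′ ⟩ =
    inj₁ ≈⟨ refl , refl , fixes-v₀-shift k refl v-fixed , refl , mod-isolate (+ 1) fib≡ , mod-isolate (- + 1) fib≡′ ⟩
  stabiliser-arc k@(mk false false _ true _ _) v-fixed@(≈ₚ⟨ _ , _ , fib≡ ⟩) ≈ₚ⟨ _ , _ , fib≡′ ⟩ =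
    inj₂ ≈⟨ refl , refl , fixes-v₀-shift k refl v-fixed , refl , mod-isolate (- + 1) fib≡ , mod-isolate (+ 1) fib≡′ ⟩

  act-path-invariant : ∀ (P : Point → Set) is → (∀ {x y} → x ≈ₚ y → P x → P y) →
                       (∀ {i x} → i ∈ is → P x → P (act (ρ i) x)) →
                       ∀ {u x} → All (_∈ is) u → P x → P (act (path u) x)
  act-path-invariant P is resp preserved {x = x} [] Px = resp (≈ₚ-sym (act-e x)) Px
  act-path-invariant P is resp preserved {i ∷ u} {x} (i∈is ∷ u∈is) Px =
    resp (≈ₚ-sym (act-∙ (ρ i) (path u) x)) (act-path-invariant P is resp preserved u∈is (preserved i∈is Px))

  path-fixes-v₀ : ∀ {u} → All (_∈ i₁ ∷ i₂ ∷ []) u → act (path u) v₀ ≈ₚ v₀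
  path-fixes-v₀ u∈ = act-path-invariant (_≈ₚ v₀) (i₁ ∷ i₂ ∷ []) ≈v₀-resp fixes u∈ (≈ₚ-refl {v₀})
    where
    ≈v₀-resp : ∀ {x y} → x ≈ₚ y → x ≈ₚ v₀ → y ≈ₚ v₀
    ≈v₀-resp x≈y x≈v₀ = ≈ₚ-trans (≈ₚ-sym x≈y) x≈v₀
    fixes : ∀ {i x} → i ∈ i₁ ∷ i₂ ∷ [] → x ≈ₚ v₀ → act (ρ i) x ≈ₚ v₀
    fixes (here refl)         x≈v₀ = act-cong (≈-refl {ρ i₁}) x≈v₀
    fixes (there (here refl)) x≈v₀ = act-cong (≈-refl {ρ i₂}) x≈v₀

  -- Orders of the face rotation τ = ρ₁ρ₀ and of the vertex rotation σ₂
  n : ℕ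
  n = h ℕ.+ h

  odd-multiple : ∀ j → odd (j ℕ.* h) ≡ odd j
  odd-multiple zero    = refl
  odd-multiple (suc j) = trans (odd-+ h (j ℕ.* h)) (cong₂ _xor_ odd-h (odd-multiple j))

  private
    cyc-τ^ : ∀ k → cyc (act (τ^ k) v₀) ≡ - + k
    cyc-τ^ k = unit (- + k)
      where
      unit : ∀ x → + 1 * + 0 + x ≡ x
      unit = solve-∀

    fib-τ^ : ∀ k → fib (act (τ^ k) v₀) ≡ sign (oddHalf (suc k))
    fib-τ^ k = unit (sign (oddHalf (suc k)))
      where
      unit : ∀ x → x * + 1 + + 0 ≡ x
      unit = solve-∀

    xor-true-differs : ∀ {x} → x ≢ x xor true
    xor-true-differs {false} ()
    xor-true-differs {true}  ()

    -- d is a multiple of h below 4h: odd multiples change the parity, 2h changes ⌊·/2⌋.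
    τ^-separated : ∀ k d → k ℕ.+ d ℕ.< n ℕ.+ n → act (τ^ k) v₀ ≈ₚ act (τ^ (k ℕ.+ d)) v₀ → d ≡ 0
    τ^-separated k d bound ≈ₚ⟨ parity≡ , cyc≡ , fib≡ ⟩ = separate (mod⇒multiple h d d≡0)
      where
      identity : ∀ k d → d ≡ - k - - (k + d)
      identity = solve-∀
      d≡0 : + d ≡ + 0 [mod h ]
      d≡0 = mod-trans (mod-reflexive (trans (identity (+ k) (+ d))
                        (cong₂ _-_ (sym (cyc-τ^ k)) (trans (cong -_ (sym (pos-+ k d))) (sym (cyc-τ^ (k ℕ.+ d)))))))
                      (mod-sub cyc≡)
      parity-flips : ∀ j → odd j ≡ true → d ≡ j ℕ.* h → ⊥
      parity-flips j odd-j refl =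
        xor-true-differs (trans parity≡ (trans (odd-+ k (j ℕ.* h)) (cong (odd k xor_) (trans (odd-multiple j) odd-j))))
      separate : (∃ λ j → d ≡ j ℕ.* h) → d ≡ 0
      separate (0 , refl) = refl
      separate (1 , d≡h) = ⊥-elim (parity-flips 1 refl d≡h)
      separate (3 , d≡3h) = ⊥-elim (parity-flips 3 refl d≡3h)
      separate (2 , refl) = ⊥-elim (xor-true-differs (trans half≡ (trans (cong oddHalf shifted) (oddHalf-addIf-2h true (suc k)))))
        where
        half≡ : oddHalf (suc k) ≡ oddHalf (suc (k ℕ.+ 2 ℕ.* h))
        half≡ = sign-injective 2<m
                  (mod-trans (mod-reflexive (sym (fib-τ^ k))) (mod-trans fib≡ (mod-reflexive (fib-τ^ (k ℕ.+ 2 ℕ.* h)))))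
        shifted : suc (k ℕ.+ 2 ℕ.* h) ≡ suc k ℕ.+ (h ℕ.+ h)
        shifted = cong (suc k ℕ.+_) (cong (h ℕ.+_) (ℕ.+-identityʳ h))
      separate (suc (suc (suc (suc j))) , refl) = ⊥-elim (ℕ.<⇒≱ bound (begin
        n ℕ.+ n                          ≡⟨ four-h h ⟩
        4 ℕ.* h                          ≤⟨ ℕ.*-monoˡ-≤ h (ℕ.m≤m+n 4 j) ⟩
        suc (suc (suc (suc j))) ℕ.* h    ≤⟨ ℕ.m≤n+m _ k ⟩
        k ℕ.+ suc (suc (suc (suc j))) ℕ.* h ∎))
        where
        open ℕ.≤-Reasoning
        four-h : ∀ h → (h ℕ.+ h) ℕ.+ (h ℕ.+ h) ≡ 4 ℕ.* h
        four-h = ℕ-solve-∀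

  private
    τ^-orbit : ∀ k → act (τ ^ k) v₀ ≈ₚ act (τ^ k) v₀
    τ^-orbit k = act-cong (τ^-closedForm k) (≈ₚ-refl {v₀})


    τ-orbit-offset : ∀ k d {l} → k ℕ.+ d ≡ l → l ℕ.< n ℕ.+ n → act (τ ^ k) v₀ ≈ₚ act (τ ^ l) v₀ → d ≡ 0
    τ-orbit-offset k d refl l< same = τ^-separated k d l< (≈ₚ-trans (≈ₚ-sym (τ^-orbit k)) (≈ₚ-trans same (τ^-orbit (k ℕ.+ d))))

    τ-orbit-ordered : ∀ {k l} → k ℕ.≤ l → l ℕ.< n ℕ.+ n → act (τ ^ k) v₀ ≈ₚ act (τ ^ l) v₀ → k ≡ l
    τ-orbit-ordered {k} {l} k≤l l< same =
      trans (sym (ℕ.+-identityʳ k)) (trans (cong (k ℕ.+_) (sym (τ-orbit-offset k (l ℕ.∸ k) k+d≡l l< same))) k+d≡l)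
      where
      k+d≡l = ℕ.m+[n∸m]≡n k≤l

  τ-orbit-injective : ∀ k l → k ℕ.< n ℕ.+ n → l ℕ.< n ℕ.+ n → act (τ ^ k) v₀ ≈ₚ act (τ ^ l) v₀ → k ≡ l
  τ-orbit-injective k l k< l< same =
    [ (λ k≤l → τ-orbit-ordered k≤l l< same) , (λ l≤k → sym (τ-orbit-ordered l≤k k< (≈ₚ-sym same))) ]′ (ℕ.≤-total k l)

  face-order : HasOrder τ (2 ℕ.* n)
  face-order = τ^2n≈e , λ k 0<k k<2n τᵏ≈e →
    let k<n+n = subst (k ℕ.<_) 2n≡n+n k<2n in
    ℕ.<-irrefl (τ-orbit-injective 0 k (ℕ.<-trans 0<k k<n+n) k<n+n (act-cong (≈-sym τᵏ≈e) (≈ₚ-refl {v₀}))) 0<k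
    where
    2n≡n+n : 2 ℕ.* n ≡ n ℕ.+ n
    2n≡n+n = cong (n ℕ.+_) (ℕ.+-identityʳ n)
    2n≡0 : - + (2 ℕ.* n) ≡ + 0 [mod h ]
    2n≡0 = - + 4 , trans (cong -_ (trans (pos-* 2 n) (cong (+ 2 *_) (pos-+ h h)))) (identity (+ h))
      where
      identity : ∀ h → - (+ 2 * (h + h)) ≡ + 0 + - + 4 * h
      identity = solve-∀
    half-vanishes : oddHalf (suc (2 ℕ.* n)) ≡ false
    half-vanishes = trans (cong₂ _xor_ half-2n (odd-2* n)) (cancel (oddHalf n))
      where
      cancel : ∀ x → ((x xor x) xor (false ∧ false)) xor false ≡ false
      cancel = solve-∀-in 𝔽₂
      half-2n : oddHalf (2 ℕ.* n) ≡ (oddHalf n xor oddHalf n) xor (false ∧ false)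
      half-2n = trans (cong oddHalf (cong (n ℕ.+_) (ℕ.+-identityʳ n)))
                  (trans (oddHalf-+ n n) (cong₂ (λ x y → (oddHalf n xor oddHalf n) xor (x ∧ y)) (odd-double h) (odd-double h)))
    τ^2n≈e : τ ^ (2 ℕ.* n) ≈ e
    τ^2n≈e = ≈-trans (τ^-closedForm (2 ℕ.* n)) ≈⟨ refl , odd-2* n , 2n≡0 , half-vanishes , mod-refl , mod-refl ⟩

  vertex-order : HasOrder (rotation false) (2 ℕ.* m)
  vertex-order = σ₂^2m≈e , nontrivial
    where
    σ₂^2m≈e : rotation false ^ (2 ℕ.* m) ≈ e
    σ₂^2m≈e = ≈-trans (σ₂^-closedForm (2 ℕ.* m))
      ≈⟨ odd-2* m , refl , mod-refl , odd-2* m , mod-reflexive (cong (λ c → if c then + 2 else + 0) (odd-2* m))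
       , (- + 4 , trans (cong (λ x → - (+ 2 * x)) (pos-* 2 m)) (identity (+ m))) ⟩
      where
      identity : ∀ m → - (+ 2 * (+ 2 * m)) ≡ + 0 + - + 4 * m
      identity = solve-∀
    nontrivial : ∀ k → 0 ℕ.< k → k ℕ.< 2 ℕ.* m → ¬ rotation false ^ k ≈ e
    nontrivial k 0<k k<2m s₂ᵏ≈e = ℕ.<⇒≱ k<2m (2m≤k (proj₁ half) (proj₂ half))
      where
      closed : σ₂^ k ≈ e
      closed = ≈-trans (≈-sym (σ₂^-closedForm k)) s₂ᵏ≈e
      half = even⇒double k (_≈_.rev≡ closed)
      identity : ∀ l → - (+ 2 * (l + l)) ≡ + 4 * - l
      identity = solve-∀
      positive-half : ∀ l → 0 ℕ.< l ℕ.+ l → 0 ℕ.< l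
      positive-half (suc l) _ = ℕ.z<s
      positive-multiple : ∀ {l} j → l ≡ j ℕ.* m → 0 ℕ.< l → m ℕ.≤ l
      positive-multiple (suc j) refl _ = ℕ.m≤m+n m (j ℕ.* m)
      2m≤k : ∀ l → k ≡ l ℕ.+ l → 2 ℕ.* m ℕ.≤ k
      2m≤k l refl = ℕ.+-mono-≤ m≤l (ℕ.≤-trans (ℕ.≤-reflexive (ℕ.+-identityʳ m)) m≤l)
        where
        l≡0 : + l ≡ + 0 [mod m ]
        4l≡0 : + 4 * - + l ≡ + 0 [mod m ]
        4l≡0 = mod-trans (mod-reflexive (sym (trans (cong (λ x → - (+ 2 * x)) (pos-+ l l)) (identity (+ l)))))
                         (_≈_.shift₁≡ closed)
        l≡0 = mod-trans (mod-reflexive (sym (neg-involutive (+ l)))) (mod-neg (four-cancel (- + l) 4l≡0))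
        m≤l = positive-multiple (proj₁ (mod⇒multiple m l l≡0)) (proj₂ (mod⇒multiple m l l≡0)) (positive-half l 0<k)

  -- ρ₀ and ρ₁ keep the fibre coordinate in {1, -1}, while ρ₂ sends -1 to 3.
  Unit : ℤ → Set
  Unit v = (v ≡ + 1 [mod m ]) ⊎ (v ≡ - + 1 [mod m ])

  ρ₂∉⟨ρ₀,ρ₁⟩ : ∀ {u} → All (_∈ i₀ ∷ i₁ ∷ []) u → ¬ path u ≈ ρ i₂
  ρ₂∉⟨ρ₀,ρ₁⟩ {u} u∈ path≈ρ₂ =
    three-not-unit (unit-resp (act-cong path≈ρ₂ (≈ₚ-refl {y})) path-keeps)
    where
    y = ⟨ false , + 0 , - + 1 ⟩
    unit-resp : ∀ {x y} → x ≈ₚ y → Unit (fib x) → Unit (fib y)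
    unit-resp ≈ₚ⟨ _ , _ , v≡ ⟩ (inj₁ c) = inj₁ (mod-trans (mod-sym v≡) c)
    unit-resp ≈ₚ⟨ _ , _ , v≡ ⟩ (inj₂ c) = inj₂ (mod-trans (mod-sym v≡) c)
    negated : ∀ {v w} → w ≡ - v → Unit v → Unit w
    negated refl (inj₁ c) = inj₂ (mod-neg c)
    negated refl (inj₂ c) = inj₁ (mod-neg c)
    flipped : ∀ v → - + 1 * v + + 0 ≡ - v
    flipped = solve-∀
    kept : ∀ v → + 1 * v + + 0 ≡ v
    kept = solve-∀
    keeps : ∀ {i x} → i ∈ i₀ ∷ i₁ ∷ [] → Unit (fib x) → Unit (fib (act (ρ i) x))
    keeps {x = ⟨ false , _ , v ⟩} (here refl)         = negated (flipped v)
    keeps {x = ⟨ true  , _ , v ⟩} (here refl)         = negated (flipped v)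
    keeps {x = ⟨ false , _ , v ⟩} (there (here refl)) = subst Unit (sym (kept v))
    keeps {x = ⟨ true  , _ , v ⟩} (there (here refl)) = negated (flipped v)
    three≢one : ¬ + 3 ≡ + 1 [mod m ]
    three≢one c = two≢zero (mod-small-unique {m} {2} {0} 2<m ℕ.z<s (mod-+ʳ (- + 1) c))
      where
      two≢zero : 2 ≢ 0
      two≢zero ()
    three≢-one : ¬ + 3 ≡ - + 1 [mod m ]
    three≢-one c =
      one≢zero (mod-small-unique {m} {1} {0} (ℕ.s≤s (ℕ.s≤s ℕ.z≤n)) ℕ.z<s (four-cancel (+ 1) (mod-+ʳ (+ 1) c)))
      where
      one≢zero : 1 ≢ 0
      one≢zero ()
    path-keeps : Unit (fib (act (path u) y))
    path-keeps = act-path-invariant (Unit ∘ fib) (i₀ ∷ i₁ ∷ []) unit-resp (λ {i} {x} → keeps {i} {x})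
                   {x = y} u∈ (inj₂ (mod-refl {x = - + 1}))
    three-not-unit : ¬ Unit (fib (act (ρ i₂) y))
    three-not-unit (inj₁ c) = three≢one c
    three-not-unit (inj₂ c) = three≢-one c

module Cyclic where

  open import Data.Nat as ℕ using (ℕ; suc)
  import Data.Nat.Properties as ℕ
  import Data.Nat.DivMod as ℕ
  open import Data.Integer using (+_; _+_; -_; _-_; _*_)
  open import Data.Integer.Properties using (pos-+)
  open import Data.Integer.Tactic.RingSolver using (solve-∀)
  open import Data.Fin using (Fin; toℕ)
  import Data.Fin.Properties as Fin
  open import Data.Bool using (Bool; true; false; not; _xor_; _∧_)
  open import Relation.Binary.PropositionalEquality

  module _ {k : ℕ} where

    private
      residue : ∀ x → + (x ℕ.% suc k) ≡ + x [mod suc k ]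
      residue x = mod-sym (mod-%ℕ (suc k) (+ x))

    inc-mod : ∀ (j : Fin (suc k)) → + toℕ (inc j) ≡ + toℕ j + + 1 [mod suc k ]
    inc-mod j = mod-trans (mod-reflexive (cong +_ (Fin.toℕ-fromℕ< _)))
                  (mod-trans (residue (suc (toℕ j))) (mod-reflexive (commute (+ toℕ j))))
      where
      commute : ∀ x → + 1 + x ≡ x + + 1
      commute = solve-∀

    dec-mod : ∀ (j : Fin (suc k)) → + toℕ (dec j) ≡ + toℕ j - + 1 [mod suc k ]
    dec-mod j = mod-trans (mod-reflexive (cong +_ (Fin.toℕ-fromℕ< _)))
                  (mod-trans (residue (toℕ j ℕ.+ k)) (+ 1 , trans (pos-+ (toℕ j) k) (wrap (+ toℕ j) (+ k))))
      where
      wrap : ∀ x k → x + k ≡ x - + 1 + + 1 * (+ 1 + k)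
      wrap = solve-∀

    neg-mod : ∀ (j : Fin (suc k)) → + toℕ (neg j) ≡ - + toℕ j [mod suc k ]
    neg-mod j = mod-trans (mod-reflexive (cong +_ (Fin.toℕ-fromℕ< _)))
                  (mod-trans (residue (suc k ℕ.∸ toℕ j)) (+ 1 , trans difference (wrap (+ toℕ j) (+ suc k))))
      where
      wrap : ∀ x k → k - x ≡ - x + + 1 * k
      wrap = solve-∀
      undo : ∀ x y → x + y - y ≡ x
      undo = solve-∀
      difference : + (suc k ℕ.∸ toℕ j) ≡ + suc k - + toℕ j
      difference = trans (sym (undo _ (+ toℕ j)))
                     (cong (_- + toℕ j) (trans (sym (pos-+ (suc k ℕ.∸ toℕ j) (toℕ j)))
                                               (cong +_ (ℕ.m∸n+n≡m (ℕ.<⇒≤ (Fin.toℕ<n j))))))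

  oddHalf-period : ℕ → Bool
  oddHalf-period 0 = true
  oddHalf-period 3 = true
  oddHalf-period _ = false

  oddHalf-mod4 : ∀ t → oddHalf t ≡ oddHalf-period (suc t ℕ.% 4)
  oddHalf-mod4 0 = refl
  oddHalf-mod4 1 = refl
  oddHalf-mod4 2 = refl
  oddHalf-mod4 3 = refl
  oddHalf-mod4 (suc (suc (suc (suc t)))) =
    trans (trans (oddHalf-+ 4 t) (xor-false (oddHalf t))) (trans (oddHalf-mod4 t) (cong oddHalf-period (sym period)))
    where
    xor-false : ∀ x → x xor (false ∧ odd t) ≡ x
    xor-false false = refl
    xor-false true  = refl
    period : suc (suc (suc (suc (suc t)))) ℕ.% 4 ≡ suc t ℕ.% 4
    period = trans (cong (ℕ._% 4) (ℕ.+-comm 4 (suc t))) (ℕ.[m+n]%n≡m%n (suc t) 4)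

  -- γ t is the paper's γ_{t+1}: it adds 1 exactly when ⌊t/2⌋ is odd.
  γ-mod : ∀ {m} t (j : Fin (suc m)) → + toℕ (γ t j) ≡ + toℕ j + sign (not (oddHalf t)) [mod suc m ]
  γ-mod t j rewrite oddHalf-mod4 t with suc t ℕ.% 4
  ... | 0 = inc-mod j
  ... | 1 = dec-mod j
  ... | 2 = dec-mod j
  ... | 3 = inc-mod j
  ... | suc (suc (suc (suc _))) = dec-mod j

open Cyclic

module Relabelling (a b : ℕ) where

  import Data.Nat.Properties as ℕ
  import Data.Nat.DivMod as ℕ
  open import Data.Integer using (ℤ; +_; _+_; _*_; -_; _-_)
  open import Data.Integer.Properties using (pos-+)
  open import Data.Integer.Tactic.RingSolver using (solve-∀)
  open import Data.Fin as Fin using (Fin; toℕ; fromℕ<)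
  import Data.Fin.Properties as Fin
  open import Data.Bool using (Bool; true; false; not; _xor_; _∧_)
  open import Data.Bool.Properties using (not-involutive; ∧-idem; not-distribˡ-xor; xor-identityʳ)
  open import Data.Product using (∃; _×_; _,_; proj₁; proj₂)
  open import Data.Sum using (_⊎_; inj₁; inj₂; [_,_]′)
  open import Relation.Nullary using (yes; no)
  open import Tactic.RingSolver using () renaming (solve-∀ to solve-∀-in)
  open import Relation.Binary.PropositionalEquality

  open TheGroup a b public

  -- The fibre coordinate 2j + 1 turns the reflection j ↦ -1 - j used by σ₁ into v ↦ -v, and
  -- the sign (-1)^⌊i/2⌋ absorbs the alternation of the γ_i, so that σ₁, σ₂ become affine.
  point : ℕ → ℤ → Point
  point t x = ⟨ odd t , + t , sign (oddHalf t) * x ⟩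

  label : Fin m → ℤ
  label j = + 2 * + toℕ j + + 1

  Φ : V n m → Point
  Φ (i , j) = point (toℕ i) (label j)

  -- 2 (b + 2) = m + 1, so b + 2 halves modulo m.
  half : ℤ
  half = + 2 + + b

  Φ⁻¹ : Point → V n m
  Φ⁻¹ ⟨ p , q , v ⟩ = fromℕ< (crt-< p q) , toFin m (half * (sign (oddHalf (crt p q)) * v - + 1))

  Φ⁻¹-Φ : ∀ x → Φ⁻¹ (Φ x) ≡ x
  Φ⁻¹-Φ (i , j) = cong₂ _,_ (Fin.toℕ-injective (trans (Fin.toℕ-fromℕ< _) t≡))
    (trans (cong (λ s → toFin m (half * (sign (oddHalf s) * (sign (oddHalf t) * label j) - + 1))) t≡)
      (trans (cong (λ x → toFin m (half * (x - + 1))) (sign-involutive (oddHalf t) (label j)))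
        (trans (toFin-cong m halved) (toFin-fromFin m j))))
    where
    t = toℕ i
    t≡ : crt (odd t) (+ t) ≡ t
    t≡ = crt-unique t (Fin.toℕ<n i)
    identity : ∀ J B → (+ 2 + B) * (+ 2 * J + + 1 - + 1) ≡ J + J * (+ 3 + (B + B))
    identity = solve-∀
    halved : half * (label j - + 1) ≡ fromFin m j [mod m ]
    halved = + toℕ j , identity (+ toℕ j) (+ b)

  Φ-Φ⁻¹ : ∀ y → Φ (Φ⁻¹ y) ≈ₚ y
  Φ-Φ⁻¹ ⟨ p , q , v ⟩ = ≈ₚ⟨ trans (cong odd t≡) (odd-crt p q) , mod-trans (mod-reflexive (cong +_ t≡)) (crt-mod p q) ,
                            subst (λ t → sign (oddHalf t) * label (toFin m Z) ≡ v [mod m ]) (sym t≡) fib≡ ⟩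
    where
    t = crt p q
    t≡ : toℕ (fromℕ< (crt-< p q)) ≡ t
    t≡ = Fin.toℕ-fromℕ< (crt-< p q)
    s = sign (oddHalf t)
    Z = half * (s * v - + 1)
    identity : ∀ s v B → + 2 * ((+ 2 + B) * (s * v - + 1)) + + 1 ≡ s * v + (s * v - + 1) * (+ 3 + (B + B))
    identity = solve-∀
    doubled : label (toFin m Z) ≡ s * v [mod m ]
    doubled = mod-trans (mod-+ʳ (+ 1) (mod-*ˡ (+ 2) (fromFin-toFin m Z))) (s * v - + 1 , identity s v (+ b))
    fib≡ : s * label (toFin m Z) ≡ v [mod m ]
    fib≡ = mod-trans (mod-*ˡ s doubled) (mod-reflexive (sign-involutive (oddHalf t) v))

  Φ⁻¹-injective : ∀ {y y′} → Φ⁻¹ y ≡ Φ⁻¹ y′ → y ≈ₚ y′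
  Φ⁻¹-injective {y} {y′} eq = ≈ₚ-trans (≈ₚ-sym (Φ-Φ⁻¹ y)) (≈ₚ-trans (≈ₚ-reflexive (cong Φ eq)) (Φ-Φ⁻¹ y′))

  Φ⁻¹-cong : ∀ {y y′} → y ≈ₚ y′ → Φ⁻¹ y ≡ Φ⁻¹ y′
  Φ⁻¹-cong {⟨ p , q , v ⟩} {⟨ _ , q′ , v′ ⟩} ≈ₚ⟨ refl , q≡ , v≡ ⟩ =
    cong₂ _,_ (Fin.toℕ-injective (trans (Fin.toℕ-fromℕ< _) (trans t≡ (sym (Fin.toℕ-fromℕ< _)))))
      (trans (cong (λ t → toFin m (half * (sign (oddHalf t) * v - + 1))) t≡)
        (toFin-cong m (mod-*ˡ half (mod-+ʳ (- + 1) (mod-*ˡ (sign (oddHalf (crt p q′))) v≡)))))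
    where
    t≡ : crt p q ≡ crt p q′
    t≡ = crt-cong refl q≡

  private
    toℕ-inc : ∀ (i : Fin n) → toℕ (inc i) ≡ suc (toℕ i) ℕ.% n
    toℕ-inc i = Fin.toℕ-fromℕ< _

    toℕ-neg : ∀ (i : Fin n) → toℕ (neg i) ≡ (n ℕ.∸ toℕ i) ℕ.% n
    toℕ-neg i = Fin.toℕ-fromℕ< _

    σ₁-cases : ∀ i (j : Fin m) → (suc (toℕ i) ≡ n × σ₁ {n} {m} (i , j) ≡ (inc i , dec (neg j)))
                                ⊎ (suc (toℕ i) ≢ n × σ₁ {n} {m} (i , j) ≡ (inc i , j))
    σ₁-cases i j with suc (toℕ i) ℕ.≟ n
    ... | yes last = inj₁ (last , refl)
    ... | no  last = inj₂ (last , refl)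

    σ₂-cases : ∀ i (j : Fin m) → (toℕ i ≡ 0 × σ₂ {n} {m} (i , j) ≡ (neg i , neg j))
                                ⊎ (∃ λ t → toℕ i ≡ suc t × σ₂ {n} {m} (i , j) ≡ (neg i , γ (suc t) j))
    σ₂-cases Fin.zero    j = inj₁ (refl , refl)
    σ₂-cases (Fin.suc i) j = inj₂ (toℕ i , refl , refl)

  point-cong : ∀ {t t′ x x′} → t ≡ t′ → x ≡ x′ [mod m ] → point t x ≈ₚ point t′ x′
  point-cong {t} refl x≡ = ≈ₚ⟨ refl , mod-refl , mod-*ˡ (sign (oddHalf t)) x≡ ⟩

  act-σ₁-point : ∀ t x → act (rotation true) (point t x) ≈ₚ point (suc t) x
  act-σ₁-point t x = ≈ₚ⟨ flip (odd t) , mod-reflexive (successor (+ t)) , mod-reflexive (fib≡ (odd t) (oddHalf t) x) ⟩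
    where
    flip : ∀ p → p xor true ≡ true xor p
    flip = solve-∀-in 𝔽₂
    successor : ∀ t → + 1 * t + + 1 ≡ + 1 + t
    successor = solve-∀
    fib≡ : ∀ p η x → sign (revAt p (rotation true)) * (sign η * x) + shiftAt p (rotation true) ≡ sign (η xor p) * x
    fib≡ false false = solve-∀
    fib≡ false true  = solve-∀
    fib≡ true  false = solve-∀
    fib≡ true  true  = solve-∀

  wrap-around : ∀ {x x′} → x′ ≡ - x [mod m ] → point 0 x′ ≈ₚ point n x
  wrap-around {x} {x′} x′≡ =
    ≈ₚ⟨ sym (odd-double h) , mod-sym 2h≡0 , mod-trans (mod-reflexive (unit x′)) (mod-trans x′≡ (mod-reflexive flipped)) ⟩
    where
    unit : ∀ x → + 1 * x ≡ x
    unit = solve-∀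
    negate : ∀ x → - x ≡ - + 1 * x
    negate = solve-∀
    flipped : - x ≡ sign (oddHalf n) * x
    flipped = trans (negate x) (cong (λ s → sign s * x) (sym oddHalf-2h))

  Φ-σ₁ : ∀ x → Φ (σ₁ x) ≈ₚ act (rotation true) (Φ x)
  Φ-σ₁ (i , j) = [ last , inner ]′ (σ₁-cases i j)
    where
    t = toℕ i
    inner : suc t ≢ n × σ₁ {n} {m} (i , j) ≡ (inc i , j) → Φ (σ₁ (i , j)) ≈ₚ act (rotation true) (Φ (i , j))
    inner (not-last , eq) rewrite eq =
      ≈ₚ-trans (point-cong (trans (toℕ-inc i) (ℕ.m<n⇒m%n≡m (ℕ.≤∧≢⇒< (Fin.toℕ<n i) not-last))) mod-refl)
               (≈ₚ-sym (act-σ₁-point t (label j)))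
    label-reflected : label (dec (neg j)) ≡ - label j [mod m ]
    label-reflected = mod-trans (mod-+ʳ (+ 1) (mod-*ˡ (+ 2) (mod-trans (dec-mod (neg j)) (mod-+ʳ (- + 1) (neg-mod j)))))
                                (mod-reflexive (identity (+ toℕ j)))
      where
      identity : ∀ J → + 2 * (- J - + 1) + + 1 ≡ - (+ 2 * J + + 1)
      identity = solve-∀
    last : suc t ≡ n × σ₁ {n} {m} (i , j) ≡ (inc i , dec (neg j)) → Φ (σ₁ (i , j)) ≈ₚ act (rotation true) (Φ (i , j))
    last (is-last , eq) rewrite eq = begin
      point (toℕ (inc i)) (label (dec (neg j)))  ≈⟨ point-cong inc-i≡0 (mod-refl {x = label (dec (neg j))}) ⟩
      point 0 (label (dec (neg j)))              ≈⟨ wrap-around label-reflected ⟩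
      point n (label j)                          ≈⟨ point-cong (sym is-last) mod-refl ⟩
      point (suc t) (label j)                    ≈⟨ act-σ₁-point t (label j) ⟨
      act (rotation true) (Φ (i , j))            ∎
      where
      open SetoidReasoning pointSetoid
      inc-i≡0 : toℕ (inc i) ≡ 0
      inc-i≡0 = trans (toℕ-inc i) (trans (cong (ℕ._% n) is-last) (ℕ.n%n≡0 n))

  complement : ∀ d t → d ℕ.+ t ≡ n → odd d ≡ odd t × oddHalf d ≡ oddHalf t xor not (odd t)
  complement d t d+t≡n = odd≡ , (begin
    oddHalf d                                                  ≡⟨ split (oddHalf d) (oddHalf t) (odd d ∧ odd t) ⟩
    ((oddHalf d xor oddHalf t) xor (odd d ∧ odd t)) xor (oddHalf t xor (odd d ∧ odd t))
                                                               ≡⟨ cong (_xor (oddHalf t xor (odd d ∧ odd t))) half-sum ⟩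
    true xor (oddHalf t xor (odd d ∧ odd t))                   ≡⟨ cong (λ c → true xor (oddHalf t xor c)) odd∧odd ⟩
    true xor (oddHalf t xor odd t)                             ≡⟨ finish (oddHalf t) (odd t) ⟩
    oddHalf t xor not (odd t)                                  ∎)
    where
    open ≡-Reasoning
    split : ∀ a b e → a ≡ ((a xor b) xor e) xor (b xor e)
    split = solve-∀-in 𝔽₂
    finish : ∀ b c → true xor (b xor c) ≡ b xor (true xor c)
    finish = solve-∀-in 𝔽₂
    recover : ∀ x y → x ≡ (x xor y) xor y
    recover = solve-∀-in 𝔽₂
    odd≡ : odd d ≡ odd t
    odd≡ = trans (recover (odd d) (odd t)) (cong (_xor odd t) (trans (sym (odd-+ d t)) (trans (cong odd d+t≡n) (odd-double h))))
    odd∧odd : odd d ∧ odd t ≡ odd t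
    odd∧odd = trans (cong (_∧ odd t) odd≡) (∧-idem (odd t))
    half-sum : (oddHalf d xor oddHalf t) xor (odd d ∧ odd t) ≡ true
    half-sum = trans (sym (oddHalf-+ d t)) (trans (cong oddHalf d+t≡n) oddHalf-2h)

  act-σ₂-point : ∀ d t x → d ℕ.+ t ≡ n →
                 point d (x + + 2 * sign (not (oddHalf t))) ≈ₚ act (rotation false) (point t x)
  act-σ₂-point d t x d+t≡n = ≈ₚ⟨ parity≡ , cyc≡ , mod-reflexive fib≡ ⟩
    where
    parity≡ : odd d ≡ odd t xor false
    parity≡ = trans (proj₁ (complement d t d+t≡n)) (sym (xor-identityʳ (odd t)))
    cancel : ∀ d t → d + t - t ≡ d
    cancel = solve-∀
    rearrange : ∀ h t → h + h - t ≡ - + 1 * t + + 0 + + 2 * h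
    rearrange = solve-∀
    cyc≡ : + d ≡ - + 1 * + t + + 0 [mod h ]
    cyc≡ = + 2 , trans (sym (cancel (+ d) (+ t)))
                   (trans (cong (_- + t) (trans (sym (pos-+ d t)) (trans (cong +_ d+t≡n) (pos-+ h h)))) (rearrange (+ h) (+ t)))
    reflect : ∀ p ω x → sign (ω xor not p) * (x + + 2 * sign (not ω))
                        ≡ sign (revAt p (rotation false)) * (sign ω * x) + shiftAt p (rotation false)
    reflect false false = solve-∀
    reflect false true  = solve-∀
    reflect true  false = solve-∀
    reflect true  true  = solve-∀
    fib≡ : sign (oddHalf d) * (x + + 2 * sign (not (oddHalf t))) ≡ fib (act (rotation false) (point t x))
    fib≡ = trans (cong (λ s → sign s * (x + + 2 * sign (not (oddHalf t)))) (proj₂ (complement d t d+t≡n)))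
                 (reflect (odd t) (oddHalf t) x)

  Φ-σ₂ : ∀ x → Φ (σ₂ x) ≈ₚ act (rotation false) (Φ x)
  Φ-σ₂ (i , j) = [ first , other ]′ (σ₂-cases i j)
    where
    t = toℕ i
    first : t ≡ 0 × σ₂ {n} {m} (i , j) ≡ (neg i , neg j) → Φ (σ₂ (i , j)) ≈ₚ act (rotation false) (Φ (i , j))
    first (t≡0 , eq) rewrite eq =
      ≈ₚ-trans (point-cong neg-i≡0 (mod-refl {x = label (neg j)}))
        (≈ₚ-trans ≈ₚ⟨ refl , mod-refl , fib≡ ⟩ (act-cong (≈-refl {rotation false}) (point-cong (sym t≡0) mod-refl)))
      where
      neg-i≡0 : toℕ (neg i) ≡ 0
      neg-i≡0 = trans (toℕ-neg i) (trans (cong (λ t → (n ℕ.∸ t) ℕ.% n) t≡0) (ℕ.n%n≡0 n))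
      identity : ∀ J → + 1 * (+ 2 * - J + + 1) ≡ - + 1 * (+ 1 * (+ 2 * J + + 1)) + + 2
      identity = solve-∀
      fib≡ : + 1 * label (neg j) ≡ - + 1 * (+ 1 * label j) + + 2 [mod m ]
      fib≡ = mod-trans (mod-*ˡ (+ 1) (mod-+ʳ (+ 1) (mod-*ˡ (+ 2) (neg-mod j)))) (mod-reflexive (identity (+ toℕ j)))
    other : (∃ λ k → t ≡ suc k × σ₂ {n} {m} (i , j) ≡ (neg i , γ (suc k) j)) →
            Φ (σ₂ (i , j)) ≈ₚ act (rotation false) (Φ (i , j))
    other (k , t≡ , eq) rewrite eq =
      ≈ₚ-trans (point-cong neg-i≡d label-γ) (act-σ₂-point d t (label j) (ℕ.m∸n+n≡m t≤n))
      where
      d = n ℕ.∸ t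
      t≤n : t ℕ.≤ n
      t≤n = ℕ.<⇒≤ (Fin.toℕ<n i)
      d<n : d ℕ.< n
      d<n = subst (λ t → n ℕ.∸ t ℕ.< n) (sym t≡) (ℕ.∸-monoʳ-< {n} {suc k} {0} ℕ.z<s (subst (ℕ._≤ n) t≡ t≤n))
      neg-i≡d : toℕ (neg i) ≡ d
      neg-i≡d = trans (toℕ-neg i) (ℕ.m<n⇒m%n≡m d<n)
      expand : ∀ J s → + 2 * (J + s) + + 1 ≡ + 2 * J + + 1 + + 2 * s
      expand = solve-∀
      label-γ : label (γ (suc k) j) ≡ label j + + 2 * sign (not (oddHalf t)) [mod m ]
      label-γ = mod-trans (mod-+ʳ (+ 1) (mod-*ˡ (+ 2) (mod-trans (γ-mod (suc k) j)
                  (mod-reflexive (cong (λ s → + toℕ j + sign (not (oddHalf s))) (sym t≡))))))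
                (mod-reflexive (expand (+ toℕ j) (sign (not (oddHalf t)))))

  Adjacentₚ : Point → Point → Set
  Adjacentₚ x y = parity y ≡ not (parity x) × ((cyc y ≡ cyc x + + 1 [mod h ]) ⊎ (cyc x ≡ cyc y + + 1 [mod h ]))

  v₀-u₀-adjacent : Adjacentₚ v₀ u₀
  v₀-u₀-adjacent = refl , inj₂ mod-refl

  act-adjacent : ∀ g {x y} → Adjacentₚ x y → Adjacentₚ (act g x) (act g y)
  act-adjacent (mk r s q _ _ _) {⟨ p , c , _ ⟩} {⟨ _ , c′ , _ ⟩} (refl , c-step) =
    sym (not-distribˡ-xor p s) , cyc-step r c-step
    where
    forward : ∀ c q → + 1 * (c + + 1) + q ≡ + 1 * c + q + + 1
    forward = solve-∀
    backward : ∀ c q → - + 1 * c + q ≡ - + 1 * (c + + 1) + q + + 1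
    backward = solve-∀
    cyc-step : ∀ r → (c′ ≡ c + + 1 [mod h ]) ⊎ (c ≡ c′ + + 1 [mod h ]) →
               (sign r * c′ + q ≡ sign r * c + q + + 1 [mod h ]) ⊎ (sign r * c + q ≡ sign r * c′ + q + + 1 [mod h ])
    cyc-step false (inj₁ e) = inj₁ (mod-trans (mod-+ʳ q (mod-*ˡ (+ 1) e)) (mod-reflexive (forward c q)))
    cyc-step false (inj₂ e) = inj₂ (mod-trans (mod-+ʳ q (mod-*ˡ (+ 1) e)) (mod-reflexive (forward c′ q)))
    cyc-step true  (inj₁ e) = inj₂ (mod-trans (mod-reflexive (backward c q)) (mod-+ʳ (+ 1) (mod-+ʳ q (mod-*ˡ (- + 1) (mod-sym e)))))
    cyc-step true  (inj₂ e) = inj₁ (mod-trans (mod-reflexive (backward c′ q)) (mod-+ʳ (+ 1) (mod-+ʳ q (mod-*ˡ (- + 1) (mod-sym e)))))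

  mod-halve : ∀ {x y} → x ≡ y [mod n ] → x ≡ y [mod h ]
  mod-halve {y = y} (q , refl) = q + q , trans (cong (λ z → y + q * z) (pos-+ h h)) (regroup y q (+ h))
    where
    regroup : ∀ y q h → y + q * (h + h) ≡ y + (q + q) * h
    regroup = solve-∀

  odd-%n : ∀ x → odd (x ℕ.% n) ≡ odd x
  odd-%n x = sym (begin
    odd x                                        ≡⟨ cong odd (ℕ.m≡m%n+[m/n]*n x n) ⟩
    odd (x ℕ.% n ℕ.+ x ℕ./ n ℕ.* n)              ≡⟨ odd-+ (x ℕ.% n) _ ⟩
    odd (x ℕ.% n) xor odd (x ℕ./ n ℕ.* n)        ≡⟨ cong (λ y → odd (x ℕ.% n) xor odd y) (ℕ.*-distribˡ-+ (x ℕ./ n) h h) ⟩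
    odd (x ℕ.% n) xor odd (x ℕ./ n ℕ.* h ℕ.+ x ℕ./ n ℕ.* h) ≡⟨ cong (odd (x ℕ.% n) xor_) (odd-double (x ℕ./ n ℕ.* h)) ⟩
    odd (x ℕ.% n) xor false                      ≡⟨ xor-false (odd (x ℕ.% n)) ⟩
    odd (x ℕ.% n)                                ∎)
    where
    open ≡-Reasoning
    xor-false : ∀ x → x xor false ≡ x
    xor-false = solve-∀-in 𝔽₂

  crt-% : ∀ x → crt (odd x) (+ x) ≡ x ℕ.% n
  crt-% x = trans (crt-cong (sym (odd-%n x)) (mod-halve (mod-%ℕ n (+ x)))) (crt-unique (x ℕ.% n) (ℕ.m%n<n x n))

  crt-successor : ∀ {p p′ q q′} → p′ ≡ not p → q′ ≡ q + + 1 [mod h ] → fromℕ< (crt-< p′ q′) ≡ inc (fromℕ< (crt-< p q))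
  crt-successor {p} {p′} {q} {q′} p′≡ q′≡ = Fin.toℕ-injective (begin
    toℕ (fromℕ< (crt-< p′ q′))         ≡⟨ Fin.toℕ-fromℕ< _ ⟩
    crt p′ q′                          ≡⟨ crt-cong parity≡ position≡ ⟩
    crt (odd (suc t)) (+ suc t)        ≡⟨ crt-% (suc t) ⟩
    suc t ℕ.% n                        ≡⟨ cong (λ t → suc t ℕ.% n) (Fin.toℕ-fromℕ< (crt-< p q)) ⟨
    suc (toℕ (fromℕ< (crt-< p q))) ℕ.% n ≡⟨ toℕ-inc (fromℕ< (crt-< p q)) ⟨
    toℕ (inc (fromℕ< (crt-< p q)))     ∎)
    where
    open ≡-Reasoning
    t = crt p q
    parity≡ : p′ ≡ odd (suc t)
    parity≡ = trans p′≡ (cong not (sym (odd-crt p q)))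
    commute : ∀ t → t + + 1 ≡ + 1 + t
    commute = solve-∀
    position≡ : q′ ≡ + suc t [mod h ]
    position≡ = mod-trans q′≡ (mod-trans (mod-+ʳ (+ 1) (mod-sym (crt-mod p q))) (mod-reflexive (commute (+ t))))

  Φ⁻¹-adjacent : ∀ {y y′} → Adjacentₚ y y′ → Adj (Φ⁻¹ y) (Φ⁻¹ y′)
  Φ⁻¹-adjacent {⟨ p , q , _ ⟩} {⟨ p′ , q′ , _ ⟩} (p′≡ , inj₁ q′≡) = inj₁ (crt-successor {p} {p′} {q} {q′} p′≡ q′≡)
  Φ⁻¹-adjacent {⟨ p , q , _ ⟩} {⟨ p′ , q′ , _ ⟩} (p′≡ , inj₂ q≡) =
    inj₂ (crt-successor {p′} {p} {q′} {q} (trans (sym (not-involutive p)) (cong not (sym p′≡))) q≡)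

  inc-coordinates : ∀ (i : Fin n) → odd (toℕ (inc i)) ≡ not (odd (toℕ i)) × (+ toℕ (inc i) ≡ + toℕ i + + 1 [mod h ])
  inc-coordinates i = trans (cong odd (toℕ-inc i)) (odd-%n (suc (toℕ i))) , mod-halve (inc-mod i)

  Φ-adjacent : ∀ {u v} → Adj u v → Adjacentₚ (Φ u) (Φ v)
  Φ-adjacent {i , _} (inj₁ refl) = proj₁ (inc-coordinates i) , inj₁ (proj₂ (inc-coordinates i))
  Φ-adjacent {_ , _} {i , _} (inj₂ refl) =
    trans (sym (not-involutive _)) (cong not (sym (proj₁ (inc-coordinates i)))) , inj₂ (proj₂ (inc-coordinates i))

Conclusion : ℕ → ℕ → Set
Conclusion n m = Σ Map λ M → Σ (Fin (Map.N M) → V n m) λ vtx →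
  IsSkeleton M vtx
  × Polytopal M vtx (2 ℕ.* n)
  × NonOrientable M
  × Reflexible M
  × HasType M (2 ℕ.* n) (2 ℕ.* m)
  × AutIsG M vtx
  × AutPlusIsG M vtx

module TheMap (a b : ℕ) where

  open import Data.Nat as ℕ using (ℕ)
  import Data.Nat.Properties as ℕ
  open import Data.Integer using (ℤ; +_; _+_; _*_; -_; _-_)
  open import Data.Integer.Tactic.RingSolver using (solve-∀)
  open import Data.Fin.Properties using (*↔×; 2↔Bool)
  open import Data.Bool using (Bool; true; false; not; _xor_)
  open import Data.List using ([]; _∷_)
  open import Data.Product using (Σ; ∃; _×_; _,_; proj₁; proj₂)
  open import Data.Product.Function.NonDependent.Propositional using (_×-↔_)
  open import Data.Sum using (inj₁; inj₂; [_,_]′)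
  open import Function using (Inverse; _↔_; mk⇔)
  open import Function.Properties.Inverse using (↔-trans; ↔-refl)
  open import Relation.Binary.PropositionalEquality

  open Relabelling a b public

  Code : Set
  Code = Bool × Bool × Fin h × Bool × Fin m × Fin m

  code : Elt → Code
  code (mk r s q η x₀ x₁) = r , s , toFin h q , η , toFin m x₀ , toFin m x₁

  uncode : Code → Elt
  uncode (r , s , q , η , x₀ , x₁) = mk r s (fromFin h q) η (fromFin m x₀) (fromFin m x₁)

  code-cong : ∀ {g g′} → g ≈ g′ → code g ≡ code g′
  code-cong ≈⟨ refl , refl , q≡ , refl , x₀≡ , x₁≡ ⟩ =
    cong₂ (λ q x → _ , _ , q , _ , x) (toFin-cong h q≡) (cong₂ _,_ (toFin-cong m x₀≡) (toFin-cong m x₁≡))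

  uncode-code : ∀ g → uncode (code g) ≈ g
  uncode-code (mk r s q η x₀ x₁) = ≈⟨ refl , refl , fromFin-toFin h q , refl , fromFin-toFin m x₀ , fromFin-toFin m x₁ ⟩

  code-uncode : ∀ c → code (uncode c) ≡ c
  code-uncode (r , s , q , η , x₀ , x₁) =
    cong₂ (λ q x → r , s , q , η , x) (toFin-fromFin h q) (cong₂ _,_ (toFin-fromFin m x₀) (toFin-fromFin m x₁))

  flagCount : ℕ
  flagCount = 2 ℕ.* (2 ℕ.* (h ℕ.* (2 ℕ.* (m ℕ.* m))))

  Fin↔Code : Fin flagCount ↔ Code
  Fin↔Code = ↔-trans *↔× (2↔Bool ×-↔ ↔-trans *↔× (2↔Bool ×-↔ ↔-trans *↔× (↔-refl ×-↔ ↔-trans *↔× (2↔Bool ×-↔ *↔×))))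

  opaque
    open Inverse Fin↔Code using (to; from; strictlyInverseˡ; strictlyInverseʳ)

    encode : Elt → Fin flagCount
    encode g = from (code g)

    decode : Fin flagCount → Elt
    decode f = uncode (to f)

    encode-cong : ∀ {g g′} → g ≈ g′ → encode g ≡ encode g′
    encode-cong g≈g′ = cong from (code-cong g≈g′)

    decode-encode : ∀ g → decode (encode g) ≈ g
    decode-encode g = ≈-trans (≈-reflexive (cong uncode (strictlyInverseˡ (code g)))) (uncode-code g)

    encode-decode : ∀ f → encode (decode f) ≡ f
    encode-decode f = trans (cong from (code-uncode (to f))) (strictlyInverseʳ f)

  open RegularMap.Flags group ρ encode decode encode-cong decode-encode encode-decode
    ρ-involutive ρ-nontrivial ρ₀ρ₂-comm ρ₀ρ₂-nontrivial rotations-generate public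

  open GroupProperties group using (∙-cancelʳ)

  vertex : Fin flagCount → V n m
  vertex f = Φ⁻¹ (act (decode f) v₀)

  perm : Elt → V n m → V n m
  perm g x = Φ⁻¹ (act g (Φ x))

  vertex-encode : ∀ g → vertex (encode g) ≡ Φ⁻¹ (act g v₀)
  vertex-encode g = Φ⁻¹-cong (act-cong (decode-encode g) (≈ₚ-refl {v₀}))

  vertex-leftMul : ∀ x f → vertex (leftMul x f) ≡ Φ⁻¹ (act (decode f) (act x v₀))
  vertex-leftMul x f = Φ⁻¹-cong (≈ₚ-trans (act-cong (decode-leftMul x f) (≈ₚ-refl {v₀})) (act-∙ x (decode f) v₀))

  vertex-rightMul : ∀ y f → vertex (rightMul y f) ≡ perm y (vertex f)
  vertex-rightMul y f = Φ⁻¹-cong (begin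
    act (decode (rightMul y f)) v₀   ≈⟨ act-cong (decode-rightMul y f) (≈ₚ-refl {v₀}) ⟩
    act (decode f ∙ y) v₀            ≈⟨ act-∙ (decode f) y v₀ ⟩
    act y (act (decode f) v₀)        ≈⟨ act-cong (≈-refl {y}) (Φ-Φ⁻¹ (act (decode f) v₀)) ⟨
    act y (Φ (vertex f))             ∎)
    where open SetoidReasoning pointSetoid

  perm-cong : ∀ {g g′} x → g ≈ g′ → perm g x ≡ perm g′ x
  perm-cong x g≈g′ = Φ⁻¹-cong (act-cong g≈g′ (≈ₚ-refl {Φ x}))

  act-rotationWord-∷ : ∀ b w {x y} → y ≈ₚ act (rotation b) x → act (rotationWord w) y ≈ₚ act (rotationWord (b ∷ w)) x
  act-rotationWord-∷ b w {x} y≈ = ≈ₚ-trans (act-cong (≈-refl {rotationWord w}) y≈) (≈ₚ-sym (act-∙ (rotation b) (rotationWord w) x))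

  evalG-perm : ∀ w x → evalG w x ≡ perm (rotationWord w) x
  evalG-perm []          x = sym (trans (Φ⁻¹-cong (act-e (Φ x))) (Φ⁻¹-Φ x))
  evalG-perm (true ∷ w)  x = trans (evalG-perm w (σ₁ x)) (Φ⁻¹-cong (act-rotationWord-∷ true w {Φ x} (Φ-σ₁ x)))
  evalG-perm (false ∷ w) x = trans (evalG-perm w (σ₂ x)) (Φ⁻¹-cong (act-rotationWord-∷ false w {Φ x} (Φ-σ₂ x)))

  perm-InG : ∀ g → InG (perm g)
  perm-InG g = let w , w≈g = rotations-generate g in
    w , λ x → trans (perm-cong x (≈-sym w≈g)) (sym (evalG-perm w x))

  fixes-quotient : ∀ f g y → Φ⁻¹ (act (decode f) y) ≡ Φ⁻¹ (act (decode g) y) → act (decode g ∙ decode f ⁻¹) y ≈ₚ y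
  fixes-quotient f g y eq = begin
    act (decode g ∙ decode f ⁻¹) y            ≈⟨ act-∙ (decode g) (decode f ⁻¹) y ⟩
    act (decode f ⁻¹) (act (decode g) y)      ≈⟨ act-cong (≈-refl {decode f ⁻¹}) (Φ⁻¹-injective eq) ⟨
    act (decode f ⁻¹) (act (decode f) y)      ≈⟨ act-⁻¹ (decode f) y ⟩
    y                                         ∎
    where open SetoidReasoning pointSetoid

  sameVertex⇒SameV : ∀ f g → vertex f ≡ vertex g → SameV flagMap f g
  sameVertex⇒SameV f g eq = subst (SameV flagMap f) (trans (leftMul-cong f path≈) (leftMul-quotient f g))
                                  (path⇒Conn (i₁ ∷ i₂ ∷ []) f u∈)
    where
    stabiliser = stabiliser-v₀ (decode g ∙ decode f ⁻¹) (fixes-quotient f g v₀ eq)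
    u∈ = proj₁ (proj₂ stabiliser)
    path≈ = proj₂ (proj₂ stabiliser)

  SameV⇒sameVertex : ∀ f g → SameV flagMap f g → vertex f ≡ vertex g
  SameV⇒sameVertex f g f~g = let u , u∈ , g≈ = Conn⇒path (i₁ ∷ i₂ ∷ []) f~g in
    sym (Φ⁻¹-cong (begin
      act (decode g) v₀                    ≈⟨ act-cong g≈ (≈ₚ-refl {v₀}) ⟩
      act (path u ∙ decode f) v₀           ≈⟨ act-∙ (path u) (decode f) v₀ ⟩
      act (decode f) (act (path u) v₀)     ≈⟨ act-cong (≈-refl {decode f}) (path-fixes-v₀ u∈) ⟩
      act (decode f) v₀                    ∎))
    where open SetoidReasoning pointSetoid

  arcElement : Bool → Point → ℤ → Elt
  arcElement r ⟨ p , q , v ⟩ v′ = mk r p q false (v - + 1) (v′ + sign ((r xor p) xor false))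

  arcElement-v₀ : ∀ r y v′ → act (arcElement r y v′) v₀ ≈ₚ y
  arcElement-v₀ r ⟨ p , q , v ⟩ v′ = ≈ₚ⟨ refl , mod-reflexive (zero-shift (sign r) q) , mod-reflexive (unit-shift v) ⟩
    where
    zero-shift : ∀ s q → s * + 0 + q ≡ q
    zero-shift = solve-∀
    unit-shift : ∀ v → + 1 * + 1 + (v - + 1) ≡ v
    unit-shift = solve-∀

  arcElement-u₀ : ∀ r y v′ → act (arcElement r y v′) u₀ ≈ₚ ⟨ not (parity y) , cyc y - sign r , v′ ⟩
  arcElement-u₀ r ⟨ p , q , v ⟩ v′ =
    ≈ₚ⟨ refl , mod-reflexive (shifted (sign r) q) , mod-reflexive (cancel (sign ((r xor p) xor false)) v′) ⟩
    where
    shifted : ∀ s q → s * - + 1 + q ≡ q - s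
    shifted = solve-∀
    cancel : ∀ s v′ → s * - + 1 + (v′ + s) ≡ v′
    cancel = solve-∀

  arc-transitive : ∀ U W → Adjacentₚ U W → ∃ λ K → act K v₀ ≈ₚ U × act K u₀ ≈ₚ W
  arc-transitive U@(⟨ p , q , v ⟩) ⟨ _ , q′ , v′ ⟩ (refl , inj₁ q′≡) =
    arcElement true U v′ , arcElement-v₀ true U v′ ,
    ≈ₚ-trans (arcElement-u₀ true U v′) ≈ₚ⟨ refl , mod-trans (mod-reflexive (successor q)) (mod-sym q′≡) , mod-refl ⟩
    where
    successor : ∀ q → q - - + 1 ≡ q + + 1
    successor = solve-∀
  arc-transitive U@(⟨ p , q , v ⟩) ⟨ _ , q′ , v′ ⟩ (refl , inj₂ q≡) =
    arcElement false U v′ , arcElement-v₀ false U v′ ,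
    ≈ₚ-trans (arcElement-u₀ false U v′) ≈ₚ⟨ refl , mod-trans (mod-+ʳ (- + 1) q≡) (mod-reflexive (predecessor q′)) , mod-refl ⟩
    where
    predecessor : ∀ q → q + + 1 - + 1 ≡ q
    predecessor = solve-∀

  vertex-r₀ : ∀ f → vertex (r i₀ f) ≡ Φ⁻¹ (act (decode f) u₀)
  vertex-r₀ f = trans (vertex-leftMul (ρ i₀) f) (Φ⁻¹-cong (act-cong (≈-refl {decode f}) act-ρ₀-v₀))

  skeleton : IsSkeleton flagMap vertex
  skeleton = record
    { vertices = λ f g → mk⇔ (sameVertex⇒SameV f g) (SameV⇒sameVertex f g)
    ; onto     = onto
    ; edgeAdj  = edgeAdj
    ; adjEdge  = adjEdge
    ; simple   = simple
    }
    where
    onto : ∀ x → ∃ λ f → vertex f ≡ x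
    onto x = let K = arcElement false (Φ x) (+ 0) in
      encode K , trans (vertex-encode K) (trans (Φ⁻¹-cong (arcElement-v₀ false (Φ x) (+ 0))) (Φ⁻¹-Φ x))
    edgeAdj : ∀ f → Adj (vertex f) (vertex (r i₀ f))
    edgeAdj f = subst (Adj (vertex f)) (sym (vertex-r₀ f))
      (Φ⁻¹-adjacent {act (decode f) v₀} {act (decode f) u₀} (act-adjacent (decode f) {v₀} {u₀} v₀-u₀-adjacent))
    adjEdge : ∀ x y → Adj x y → ∃ λ f → vertex f ≡ x × vertex (r i₀ f) ≡ y
    adjEdge x y adj = let K , Kv₀≈ , Ku₀≈ = arc-transitive (Φ x) (Φ y) (Φ-adjacent {x} {y} adj) in
      encode K , trans (vertex-encode K) (trans (Φ⁻¹-cong Kv₀≈) (Φ⁻¹-Φ x))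
               , trans (vertex-r₀ (encode K)) (trans (Φ⁻¹-cong (act-cong (decode-encode K) (≈ₚ-refl {u₀})))
                                                     (trans (Φ⁻¹-cong Ku₀≈) (Φ⁻¹-Φ y)))
    simple : ∀ f g → vertex f ≡ vertex g → vertex (r i₀ f) ≡ vertex (r i₀ g) → SameE flagMap f g
    simple f g same-v same-u = [ trivial , reflection ]′ (stabiliser-arc K (fixes-quotient f g v₀ same-v) fixes-u₀)
      where
      K = decode g ∙ decode f ⁻¹
      fixes-u₀ : act K u₀ ≈ₚ u₀
      fixes-u₀ = fixes-quotient f g u₀ (trans (sym (vertex-r₀ f)) (trans same-u (vertex-r₀ g)))
      reaches : ∀ {u} → All (_∈ i₀ ∷ i₂ ∷ []) u → path u ≈ K → SameE flagMap f g
      reaches {u} u∈ path≈ =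
        subst (SameE flagMap f) (trans (leftMul-cong f path≈) (leftMul-quotient f g)) (path⇒Conn (i₀ ∷ i₂ ∷ []) f u∈)
      trivial : K ≈ e → SameE flagMap f g
      trivial K≈e = reaches [] (≈-sym K≈e)
      reflection : K ≈ ρ i₂ → SameE flagMap f g
      reflection K≈ρ₂ = reaches (there (here refl) ∷ []) (≈-trans (∙-identityʳ (ρ i₂)) (≈-sym K≈ρ₂))

  faceStep≗τ : ∀ f → faceStep flagMap f ≡ leftMul τ f
  faceStep≗τ f = leftMul-∙ (ρ i₁) (ρ i₀) f

  polytopal : Polytopal flagMap vertex (2 ℕ.* n)
  polytopal = face-is-cycle , two-faces
    where
    2n≡n+n : 2 ℕ.* n ≡ n ℕ.+ n
    2n≡n+n = cong (n ℕ.+_) (ℕ.+-identityʳ n)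
    face-is-cycle : ∀ f k l → k ℕ.< 2 ℕ.* n → l ℕ.< 2 ℕ.* n →
                    vertex (iter k (faceStep flagMap) f) ≡ vertex (iter l (faceStep flagMap) f) → k ≡ l
    face-is-cycle f k l k< l< eq = τ-orbit-injective k l (subst (k ℕ.<_) 2n≡n+n k<) (subst (l ℕ.<_) 2n≡n+n l<)
      (act-injective (decode f) (Φ⁻¹-injective (begin
        Φ⁻¹ (act (decode f) (act (τ ^ k) v₀))       ≡⟨ vertex-leftMul (τ ^ k) f ⟨
        vertex (leftMul (τ ^ k) f)                  ≡⟨ cong vertex (iter-leftMul′ τ faceStep≗τ k f) ⟨
        vertex (iter k (faceStep flagMap) f)        ≡⟨ eq ⟩
        vertex (iter l (faceStep flagMap) f)        ≡⟨ cong vertex (iter-leftMul′ τ faceStep≗τ l f) ⟩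
        vertex (leftMul (τ ^ l) f)                  ≡⟨ vertex-leftMul (τ ^ l) f ⟩
        Φ⁻¹ (act (decode f) (act (τ ^ l) v₀))       ∎)))
      where open ≡-Reasoning
    two-faces : ∀ f → ¬ SameF flagMap f (r i₂ f)
    two-faces f f~r₂f = let u , u∈ , r₂f≈ = Conn⇒path (i₀ ∷ i₁ ∷ []) f~r₂f in
      ρ₂∉⟨ρ₀,ρ₁⟩ u∈ (∙-cancelʳ (decode f) (path u) (ρ i₂)
                      (≈-trans (≈-sym r₂f≈) (decode-leftMul (ρ i₂) f)))

  hasType-2n-2m : HasType flagMap (2 ℕ.* n) (2 ℕ.* m)
  hasType-2n-2m = hasType {2 ℕ.* n} {2 ℕ.* m} face-order vertex-order

  autIsG : AutIsG flagMap vertex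
  autIsG = automorphism⇒G , G⇒automorphism
    where
    automorphism⇒G : ∀ φ → IsAut flagMap φ → ∃ λ (g : V n m → V n m) → InG g × Induces flagMap vertex φ g
    automorphism⇒G φ φ-aut = let y = decode (φ (encode e)) in
      perm y , perm-InG y , λ f → trans (cong vertex (isAut⇒rightMul φ φ-aut f)) (vertex-rightMul y f)
    G⇒automorphism : ∀ (g : V n m → V n m) → InG g → ∃ λ φ → IsAut flagMap φ × Induces flagMap vertex φ g
    G⇒automorphism g (w , g≗w) = rightMul (rotationWord w) , rightMul-isAut _ ,
      λ f → trans (vertex-rightMul _ f) (trans (sym (evalG-perm w (vertex f))) (sym (g≗w (vertex f))))

  autPlusIsG : AutPlusIsG flagMap vertex
  autPlusIsG f₀ R S distinguished = rotations⇒G , G⇒rotations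
    where
    open Conjugation group (decode f₀)
    evalF≗ = distinguished⇒evalF f₀ R S distinguished
    rotations⇒G : ∀ w → ∃ λ (g : V n m → V n m) → InG g × Induces flagMap vertex (evalF flagMap R S w) g
    rotations⇒G w = perm (conj (rotationWord w)) , perm-InG (conj (rotationWord w)) ,
      λ f → trans (cong vertex (evalF≗ w f)) (vertex-rightMul _ f)
    G⇒rotations : ∀ (g : V n m → V n m) → InG g → ∃ λ w → Induces flagMap vertex (evalF flagMap R S w) g
    G⇒rotations g (W , g≗W) = w , λ f → begin
      vertex (evalF flagMap R S w f)                 ≡⟨ cong vertex (evalF≗ w f) ⟩
      vertex (rightMul (conj (rotationWord w)) f)    ≡⟨ vertex-rightMul (conj (rotationWord w)) f ⟩
      perm (conj (rotationWord w)) (vertex f)        ≡⟨ perm-cong (vertex f) conj-w≈W ⟩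
      perm (rotationWord W) (vertex f)               ≡⟨ evalG-perm W (vertex f) ⟨
      evalG W (vertex f)                             ≡⟨ g≗W (vertex f) ⟨
      g (vertex f)                                   ∎
      where
      open ≡-Reasoning
      target = decode f₀ ∙ rotationWord W ∙ decode f₀ ⁻¹
      w = proj₁ (rotations-generate target)
      conj-w≈W : conj (rotationWord w) ≈ rotationWord W
      conj-w≈W = ≈-trans (conj-cong {rotationWord w} {target} (proj₂ (rotations-generate target)))
                         (conj-surjective (rotationWord W))

  conclusion : Conclusion n m
  conclusion =
    flagMap , vertex , skeleton , polytopal , nonOrientable , reflexible , hasType-2n-2m , autIsG , autPlusIsG

open import Data.Nat using (_+_; _*_; _≤_; _<_; s≤s)
import Data.Nat.Properties as ℕ
open import Data.Nat.Divisibility using (_∣_; divides)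
open import Data.Nat.Tactic.RingSolver using (solve-∀)
open import Data.Empty using (⊥-elim)
open import Relation.Binary.PropositionalEquality using (refl; sym; trans; cong₂; subst₂)

odd-as-suc-double : ∀ k → ¬ 2 ∣ k → ∃ λ j → k ≡ suc (j + j)
odd-as-suc-double k 2∤k with odd k in parity
... | true  = odd⇒suc-double k parity
... | false = let j , k≡j+j = even⇒double k parity in ⊥-elim (2∤k (divides j (trans k≡j+j (double j))))
  where
  double : ∀ j → j + j ≡ j * 2
  double = solve-∀

odd≥3-as-3+double : ∀ m → 3 ≤ m → ¬ 2 ∣ m → ∃ λ b → m ≡ 3 + (b + b)
odd≥3-as-3+double m 3≤m 2∤m with odd-as-suc-double m 2∤m
... | zero  , refl = ⊥-elim (3≰1 3≤m)
  where
  3≰1 : ¬ 3 ≤ 1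
  3≰1 (s≤s ())
... | suc b , m≡ = b , trans m≡ (cong (λ x → suc (suc x)) (ℕ.+-suc b b))

twice-odd : ∀ s → 2 ∣ s → ¬ 4 ∣ s → ∃ λ u → s ≡ suc (u + u) * 2
twice-odd s (divides q s≡) 4∤s = let u , q≡ = odd-as-suc-double q 2∤q in u , trans s≡ (cong (_* 2) q≡)
  where
  quadruple : ∀ r → r * 2 * 2 ≡ r * 4
  quadruple = solve-∀
  2∤q : ¬ 2 ∣ q
  2∤q (divides r q≡) = 4∤s (divides r (trans s≡ (trans (cong (_* 2) q≡) (quadruple r))))

proposition5p5 : (m s : ℕ) → 3 ≤ m → ¬ (2 ∣ m) → 0 < s → 2 ∣ s → ¬ (4 ∣ s) →
    Σ Map λ M → Σ (Fin (Map.N M) → V (s * m) m) λ vtx →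
      IsSkeleton M vtx
      × Polytopal M vtx (2 * (s * m))
      × NonOrientable M
      × Reflexible M
      × HasType M (2 * (s * m)) (2 * m)
      × AutIsG M vtx
      × AutPlusIsG M vtx
proposition5p5 m s 3≤m 2∤m _ 2∣s 4∤s =
  let b , m≡ = odd≥3-as-3+double m 3≤m 2∤m
      u , s≡ = twice-odd s 2∣s 4∤s
      a = u * b * 2 + u * 3 + b
  in subst₂ Conclusion (sym (trans (cong₂ _*_ s≡ m≡) (expand u b))) (sym m≡) (TheMap.conclusion a b)
  where
  -- s · m = 2 (2u + 1) (2b + 3) = 2 (2a + 3)
  expand : ∀ u b → suc (u + u) * 2 * (3 + (b + b))
                   ≡ 3 + ((u * b * 2 + u * 3 + b) + (u * b * 2 + u * 3 + b))
                     + (3 + ((u * b * 2 + u * 3 + b) + (u * b * 2 + u * 3 + b)))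
  expand = solve-∀
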